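{- Let $n\ge 2$, $q=2^n$, $h(y)=y^{q/2}+y^{q/4}+\dots+y^2+y$. Enumerate $\mathbb{F}_{q^2}=\{x_1,\dots,x_{q^2}\}$ and for each $j$ let $y_{j,1},\dots,y_{j,q/2}$ be the $q/2$ distinct elements $y\in\mathbb{F}_{q^2}$ with $h(y)=x_j^{q+1}$. (1) Let $a_1,a_2\in\mathbb{F}_{q^2}$ and let $p_1(x),p_2(x)\in\mathbb{F}_{q^2}[x]$ be polynomials of degree at most $3$. If there is a subset $J\subseteq\{1,\dots,q^2\}$ with $|J|\ge 4$ such that $a_1y_{j,\ell}+p_1(x_j)=a_2y_{j,\ell}+p_2(x_j)$ for all $j\in J$ and all $\ell\in\{1,\dots,q/2\}$, then $a_1=a_2$ and $p_1=p_2$. (2) Let $a,c\in\mathbb{F}_{q^2}^*$, $b\in\mathbb{F}_{q^2}$, and $s(x)\in\mathbb{F}_{q^2}[x]$ of degree at most $3$. If $h(cy_{j,\ell}+s(x_j))=(ax_j+b)^{q+1}$ for all $1\le j\le q^2$ and $1\le\ell\le q/2$, then $c=1$ and $s(x)=a^2b^{2q}x^2+ab^qx+e$ for some $e\in\mathbb{F}_{q^2}$ with $b^{q+1}=h(e)$. -}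

module Defs where

open import Level using (0ℓ)
open import Data.Nat as ℕ using (ℕ; zero; suc)
open import Data.Fin using (Fin)
open import Data.Vec using (Vec; []; _∷_)
open import Data.Product using (∃)
open import Relation.Binary.PropositionalEquality using (_≡_; _≢_)
open import Algebra.Core using (Op₁; Op₂)
open import Algebra.Structures using (IsCommutativeRing)
open import Function.Bundles using (_↔_)

-- A finite field with exactly N elements (equality is propositional).
-- 'enum' is a bijection Fin N ↔ Carrier, i.e. an enumeration x₁,…,x_N.
record FiniteField (N : ℕ) : Set₁ where
  infixl 6 _+_
  infixl 7 _*_
  field
    Carrier : Set
    _+_ _*_ : Op₂ Carrier
    -_      : Op₁ Carrier
    0# 1#   : Carrier
    isCommutativeRing : IsCommutativeRing _≡_ _+_ _*_ -_ 0# 1#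
    0≢1     : 0# ≢ 1#
    inverse : ∀ x → x ≢ 0# → ∃ λ y → x * y ≡ 1#
    enum    : Fin N ↔ Carrier

  infixr 8 _↑_
  _↑_ : Carrier → ℕ → Carrier
  x ↑ zero  = 1#
  x ↑ suc k = x * (x ↑ k)

  hsum : ℕ → Carrier → Carrier
  hsum zero    y = 0#
  hsum (suc k) y = y ↑ (2 ℕ.^ k) + hsum k y

  Poly≤3 : Set
  Poly≤3 = Vec Carrier 4

  eval : Poly≤3 → Carrier → Carrier
  eval (c₀ ∷ c₁ ∷ c₂ ∷ c₃ ∷ []) x = c₀ + c₁ * x + c₂ * (x ↑ 2) + c₃ * (x ↑ 3)

{-# OPTIONS --safe #-}
module Submission where

-- Write h = hsum n and N(x) = x ↑ (q + 1). In characteristic 2, h is additive and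
-- h(y)² + h(y) = y^q + y, so every value h(y), and every norm N(x) (as N(x)^q = N(x)),
-- is a root of (w² + w)^q + (w² + w), which has degree 2q. Counting roots, the kernel
-- of h has at most q/2 elements and its image at most 2q; since q² ≤ |image|·|kernel|
-- both bounds are attained, so every norm lies in the image and each fibre h⁻¹(N(x))
-- is a coset of a kernel containing some k ≠ 0.
-- (1) Comparing a y + p(x) at y and y + k gives a₁ = a₂, and then p₁, p₂ agree at
-- four distinct points.
-- (2) At x = 0 the hypothesis says that y ↦ c y preserves the kernel. Writing
-- h(y) = y^(q/2) + h′(y), the polynomials h′(c y) and c^(q/2) h′(y) agree on the q/2
-- kernel elements and have degree < q/2; their coefficients of y and y² give
-- c = c^(q/2) = c², so c = 1. Then h(s(x)) = N(x) + N(a x + b) for every x, an identity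
-- of polynomials of degree < q², and its coefficients of x, x², x³ together with its
-- value at 0 determine s.

open import Defs
open import Level using (0ℓ)
open import Data.Bool using (true; false; if_then_else_)
open import Data.Nat as ℕ using (ℕ; _≤_; _^_; zero; suc; z≤n; s≤s; z<s; s<s)
import Data.Nat.Properties as ℕ
open import Data.Nat.Tactic.RingSolver using (solve-∀)
open import Data.Fin as Fin using (Fin)
import Data.Fin.Properties as Fin
open import Data.Fin.Patterns using (0F; 1F; 2F; 3F)
open import Data.Fin.Subset using (Subset; _∈_; ∣_∣)
open import Data.Vec as Vec using ([]; _∷_)
open import Data.Vec.Functional using (Vector; removeAt; replicate)
open import Data.Product using (_×_; ∃; _,_; proj₁; proj₂; map₁; map₂)
open import Data.Sum using (_⊎_; inj₁; inj₂; fromInj₂)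
open import Data.List as List using (List; []; _∷_; _++_; length)
import Data.List.Properties as List
open import Data.List.Relation.Unary.All as All using (All; []; _∷_)
import Data.List.Relation.Unary.All.Properties as All
open import Data.List.Relation.Unary.Any as Any using (Any)
open import Data.List.Relation.Unary.AllPairs using ([]; _∷_)
open import Data.List.Relation.Unary.Unique.Propositional using (Unique)
import Data.List.Relation.Unary.Unique.Propositional.Properties as Unique
open import Data.List.Membership.Propositional using () renaming (_∈_ to _∈ₗ_)
import Data.List.Membership.Propositional.Properties as Membership
import Data.List.Membership.Setoid.Properties as SetoidMembership
open import Function using (_∘_; _↔_; Inverse; Injection; mk↔ₛ′)
open import Function.Properties.Inverse using (↔⇒↣; ↔-sym)
open import Function.Construct.Composition using (_↔-∘_)
open import Relation.Binary.Definitions using (DecidableEquality)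
open import Relation.Binary.PropositionalEquality
open import Relation.Nullary using (Dec; yes; no; contradiction)
open import Relation.Nullary.Decidable using (via-injection; does; dec-true; dec-false)
open import Algebra.Bundles using (CommutativeMonoid; CommutativeRing; CancellativeCommutativeSemiring)
open import Algebra.Structures using (IsCommutativeRing)
open import Algebra.Definitions using (AlmostLeftCancellative)
import Algebra.Properties.CommutativeMonoid.Sum as CommutativeMonoidSum
open ≡-Reasoning

≤-*-tight : ∀ {a b c d} → 0 ℕ.< a → 0 ℕ.< b → a ℕ.* b ≤ c ℕ.* d → c ≤ a → d ≤ b → a ≤ c × b ≤ d
≤-*-tight {a} {b} {c} {d} 0<a 0<b ab≤cd c≤a d≤b =
  ℕ.*-cancelʳ-≤ a c b {{ℕ.>-nonZero 0<b}} (ℕ.≤-trans ab≤cd (ℕ.*-monoʳ-≤ c d≤b)) ,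
  ℕ.*-cancelˡ-≤ a {{ℕ.>-nonZero 0<a}} (ℕ.≤-trans ab≤cd (ℕ.*-monoˡ-≤ d c≤a))

module _ {A : Set} where

  ∃-∈ : ∀ {xs : List A} → 0 ℕ.< length xs → ∃ (_∈ₗ xs)
  ∃-∈ {x ∷ _} _ = x , Any.here refl

  ∃-∈-≢ : DecidableEquality A → ∀ a {xs : List A} → Unique xs → 2 ≤ length xs → ∃ λ x → x ∈ₗ xs × x ≢ a
  ∃-∈-≢ _≟_ a {x ∷ y ∷ _} ((x≢y ∷ _) ∷ _) (s≤s (s≤s z≤n)) with x ≟ a
  ... | yes refl = y , Any.there (Any.here refl) , x≢y ∘ sym
  ... | no  x≢a  = x , Any.here refl , x≢a

members : ∀ {n} → Subset n → List (Fin n)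
members []          = []
members (true  ∷ p) = Fin.zero ∷ List.map Fin.suc (members p)
members (false ∷ p) = List.map Fin.suc (members p)

length-members : ∀ {n} (p : Subset n) → length (members p) ≡ ∣ p ∣
length-members []          = refl
length-members (true  ∷ p) = cong suc (trans (List.length-map Fin.suc (members p)) (length-members p))
length-members (false ∷ p) = trans (List.length-map Fin.suc (members p)) (length-members p)

∈-members⁻ : ∀ {n} (p : Subset n) {i} → i ∈ₗ members p → i ∈ p
∈-members⁻ (true  ∷ p) (Any.here refl) = Vec.here
∈-members⁻ (true  ∷ p) (Any.there i∈) with Membership.∈-map⁻ Fin.suc i∈
... | j , j∈ , refl = Vec.there (∈-members⁻ p j∈)
∈-members⁻ (false ∷ p) i∈ with Membership.∈-map⁻ Fin.suc i∈
... | j , j∈ , refl = Vec.there (∈-members⁻ p j∈)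

members-unique : ∀ {n} (p : Subset n) → Unique (members p)
members-unique []          = []
members-unique (true  ∷ p) = All.map⁺ (All.tabulate (λ _ ())) ∷ Unique.map⁺ Fin.suc-injective (members-unique p)
members-unique (false ∷ p) = Unique.map⁺ Fin.suc-injective (members-unique p)

module _ {c ℓ} (M : CommutativeMonoid c ℓ) where
  open CommutativeMonoid M using (Carrier; _≈_; ε; ∙-congˡ; identityʳ)
    renaming (trans to ≈-trans; reflexive to ≈-reflexive)
  open CommutativeMonoidSum M

  sum-reindex : ∀ {n} {A : Set} (enum : Fin n ↔ A) (σ : A ↔ A) (f : A → Carrier) →
                sum (f ∘ Inverse.to enum) ≈ sum (f ∘ Inverse.to σ ∘ Inverse.to enum)
  sum-reindex {n} enum σ f = ≈-trans (sum-permute (f ∘ to enum) π)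
    (≈-reflexive (sum-cong-≗ {n} (λ i → cong f (strictlyInverseˡ enum (to σ (to enum i))))))
    where
    open Inverse
    π : Fin n ↔ Fin n
    π = ↔-sym enum ↔-∘ (σ ↔-∘ enum)

  sum-single : ∀ {n} (f : Vector Carrier n) i → (∀ j → j ≢ i → f j ≈ ε) → sum f ≈ f i
  sum-single {suc n} f i others = ≈-trans (sum-remove {i = i} f) (≈-trans (∙-congˡ rest) (identityʳ (f i)))
    where
    rest : sum (removeAt f i) ≈ ε
    rest = ≈-trans (sum-cong-≋ (λ j → others _ (Fin.punchInᵢ≢i i j))) (sum-replicate-zero n)

module FieldProperties {N : ℕ} (F : FiniteField N) where
  open FiniteField F
  open IsCommutativeRing isCommutativeRing public
    using ( +-assoc; +-comm; +-identityˡ; +-identityʳ; -‿inverseʳ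
          ; -‿inverseˡ; *-assoc; *-comm; *-identityˡ; *-identityʳ; zeroˡ; zeroʳ; distribˡ; distribʳ)

  commutativeRing : CommutativeRing 0ℓ 0ℓ
  commutativeRing = record { isCommutativeRing = isCommutativeRing }
  open CommutativeRing commutativeRing public using (_-_)
  open CommutativeRing commutativeRing using (ring; +-group; +-commutativeMonoid; *-commutativeMonoid; semiring; commutativeSemiring; isCommutativeSemiring)
  open import Algebra.Properties.Group +-group public using (∙-cancelˡ; ∙-cancelʳ; x∙y⁻¹≈ε⇒x≈y; x≈y⇒x∙y⁻¹≈ε)
  open import Algebra.Properties.Ring ring public using (-1*x≈-x)
  import Algebra.Properties.CommutativeSemiring.Exp commutativeSemiring as Exp
  import Algebra.Properties.Semiring.Mult semiring as Mult
  open import Algebra.Solver.Ring.NaturalCoefficients.Default commutativeSemiring public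
    using (solve; _:+_; _:*_; _:=_)
  module ∑ = CommutativeMonoidSum +-commutativeMonoid
  module ∏ = CommutativeMonoidSum *-commutativeMonoid

  infix 4 _≟_
  _≟_ : DecidableEquality Carrier
  _≟_ = via-injection (↔⇒↣ (↔-sym enum)) Fin._≟_

  *-cancelˡ-nonZero : AlmostLeftCancellative _≡_ 0# _*_
  *-cancelˡ-nonZero x y z x≢0 xy≡xz = begin
    y                    ≡⟨ sym (*-identityˡ y) ⟩
    1# * y               ≡⟨ cong (_* y) (sym x⁻¹x≡1) ⟩
    (x⁻¹ * x) * y        ≡⟨ *-assoc x⁻¹ x y ⟩
    x⁻¹ * (x * y)        ≡⟨ cong (x⁻¹ *_) xy≡xz ⟩
    x⁻¹ * (x * z)        ≡⟨ sym (*-assoc x⁻¹ x z) ⟩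
    (x⁻¹ * x) * z        ≡⟨ cong (_* z) x⁻¹x≡1 ⟩
    1# * z               ≡⟨ *-identityˡ z ⟩
    z                    ∎
    where
    x⁻¹ = proj₁ (inverse x x≢0)
    x⁻¹x≡1 : x⁻¹ * x ≡ 1#
    x⁻¹x≡1 = trans (*-comm x⁻¹ x) (proj₂ (inverse x x≢0))

  cancellativeCommutativeSemiring : CancellativeCommutativeSemiring 0ℓ 0ℓ
  cancellativeCommutativeSemiring = record
    { isCancellativeCommutativeSemiring = record
      { isCommutativeSemiring = isCommutativeSemiring
      ; *-cancelˡ-nonZero     = *-cancelˡ-nonZero
      }
    }
  open import Algebra.Properties.CancellativeCommutativeSemiring cancellativeCommutativeSemiring
    using (xy≈0⇒x≈0∨y≈0; x≉0∧y≉0⇒xy≉0)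

  xy≡0⇒x≡0∨y≡0 : ∀ {x y} → x * y ≡ 0# → x ≡ 0# ⊎ y ≡ 0#
  xy≡0⇒x≡0∨y≡0 = xy≈0⇒x≈0∨y≈0 _≟_

  x≢0∧y≢0⇒xy≢0 : ∀ {x y} → x ≢ 0# → y ≢ 0# → x * y ≢ 0#
  x≢0∧y≢0⇒xy≢0 = x≉0∧y≉0⇒xy≉0 _≟_

  ↑≡^ : ∀ x k → x ↑ k ≡ x Exp.^ k
  ↑≡^ x zero    = refl
  ↑≡^ x (suc k) = cong (x *_) (↑≡^ x k)

  ↑-homo-* : ∀ x m n → x ↑ (m ℕ.+ n) ≡ x ↑ m * x ↑ n
  ↑-homo-* x m n = trans (↑≡^ x (m ℕ.+ n))
    (trans (Exp.^-homo-* x m n) (sym (cong₂ _*_ (↑≡^ x m) (↑≡^ x n))))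

  ↑-assocʳ : ∀ x m n → (x ↑ m) ↑ n ≡ x ↑ (m ℕ.* n)
  ↑-assocʳ x m n = trans (trans (↑≡^ (x ↑ m) n) (cong (Exp._^ n) (↑≡^ x m)))
    (trans (Exp.^-assocʳ x m n) (sym (↑≡^ x (m ℕ.* n))))

  ↑-distrib-* : ∀ x y n → (x * y) ↑ n ≡ x ↑ n * y ↑ n
  ↑-distrib-* x y n = trans (↑≡^ (x * y) n)
    (trans (Exp.^-distrib-* x y n) (sym (cong₂ _*_ (↑≡^ x n) (↑≡^ y n))))

  x↑1≡x : ∀ x → x ↑ 1 ≡ x
  x↑1≡x = *-identityʳ

  1↑k≡1 : ∀ k → 1# ↑ k ≡ 1#
  1↑k≡1 zero    = refl
  1↑k≡1 (suc k) = trans (*-identityˡ _) (1↑k≡1 k)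

  x-y+y≡x : ∀ x y → x - y + y ≡ x
  x-y+y≡x x y = trans (+-assoc x (- y) y) (trans (cong (x +_) (-‿inverseˡ y)) (+-identityʳ x))

  x↑2≡x*x : ∀ x → x ↑ 2 ≡ x * x
  x↑2≡x*x x = cong (x *_) (*-identityʳ x)

  1≢0 : 1# ≢ 0#
  1≢0 = 0≢1 ∘ sym

  0↑k≡0 : ∀ {k} → 0 ℕ.< k → 0# ↑ k ≡ 0#
  0↑k≡0 {suc k} _ = zeroˡ _

  x↑k≡0⇒x≡0 : ∀ {x} k → x ↑ k ≡ 0# → x ≡ 0#
  x↑k≡0⇒x≡0 zero    1≡0 = contradiction 1≡0 1≢0
  x↑k≡0⇒x≡0 (suc k) eq with xy≡0⇒x≡0∨y≡0 eq
  ... | inj₁ x≡0 = x≡0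
  ... | inj₂ x↑k≡0 = x↑k≡0⇒x≡0 k x↑k≡0

  ^×1≡×1↑ : ∀ m k → (m ^ k) Mult.× 1# ≡ (m Mult.× 1#) ↑ k
  ^×1≡×1↑ m zero    = Mult.×-homo-1 1#
  ^×1≡×1↑ m (suc k) = trans (Mult.×1-homo-* m (m ^ k)) (cong (m Mult.× 1# *_) (^×1≡×1↑ m k))

  slopes-agree : ∀ {a₁ a₂ u₁ u₂ y k} → k ≢ 0# → a₁ * y + u₁ ≡ a₂ * y + u₂ →
                 a₁ * (y + k) + u₁ ≡ a₂ * (y + k) + u₂ → a₁ ≡ a₂
  slopes-agree {a₁} {a₂} {u₁} {u₂} {y} {k} k≢0 at-y at-y+k =
    *-cancelˡ-nonZero k a₁ a₂ k≢0 (trans (*-comm k a₁) (trans a₁k≡a₂k (*-comm a₂ k)))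
    where
    split : ∀ a u → a * (y + k) + u ≡ (a * y + u) + a * k
    split a u = solve 4 (λ a y k u → (a :* (y :+ k) :+ u) := ((a :* y :+ u) :+ a :* k)) refl a y k u
    a₁k≡a₂k : a₁ * k ≡ a₂ * k
    a₁k≡a₂k = ∙-cancelˡ (a₂ * y + u₂) _ _ (begin
      (a₂ * y + u₂) + a₁ * k    ≡⟨ cong (_+ a₁ * k) at-y ⟨
      (a₁ * y + u₁) + a₁ * k    ≡⟨ split a₁ u₁ ⟨
      a₁ * (y + k) + u₁         ≡⟨ at-y+k ⟩
      a₂ * (y + k) + u₂         ≡⟨ split a₂ u₂ ⟩
      (a₂ * y + u₂) + a₂ * k    ∎)

  element : Fin N → Carrier
  element = Inverse.to enum

  translation : Carrier → Carrier ↔ Carrier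
  translation a = mk↔ₛ′ (_+ a) (_+ - a) (cancel a (- a) (-‿inverseˡ a)) (cancel (- a) a (-‿inverseʳ a))
    where
    cancel : ∀ a b → b + a ≡ 0# → ∀ y → (y + b) + a ≡ y
    cancel a b b+a≡0 y = trans (+-assoc y b a) (trans (cong (y +_) b+a≡0) (+-identityʳ y))

  dilation : ∀ a → a ≢ 0# → Carrier ↔ Carrier
  dilation a a≢0 = mk↔ₛ′ (a *_) (a⁻¹ *_) (cancel a a⁻¹ aa⁻¹≡1) (cancel a⁻¹ a (trans (*-comm a⁻¹ a) aa⁻¹≡1))
    where
    a⁻¹ = proj₁ (inverse a a≢0)
    aa⁻¹≡1 : a * a⁻¹ ≡ 1#
    aa⁻¹≡1 = proj₂ (inverse a a≢0)
    cancel : ∀ a b → a * b ≡ 1# → ∀ y → a * (b * y) ≡ y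
    cancel a b ab≡1 y = trans (sym (*-assoc a b y)) (trans (cong (_* y) ab≡1) (*-identityˡ y))

  card×1≡0 : N Mult.× 1# ≡ 0#
  card×1≡0 = ∙-cancelˡ (∑.sum element) _ _ (begin
    ∑.sum element + N Mult.× 1#                   ≡⟨ cong (∑.sum element +_) (sym (∑.sum-replicate N)) ⟩
    ∑.sum element + ∑.sum (replicate N 1#)        ≡⟨ sym (∑.∑-distrib-+ element (replicate N 1#)) ⟩
    ∑.sum (λ i → element i + 1#)                  ≡⟨ sym (sum-reindex +-commutativeMonoid enum (translation 1#) (λ y → y)) ⟩
    ∑.sum element                                 ≡⟨ sym (+-identityʳ _) ⟩
    ∑.sum element + 0#                            ∎)

  characteristic-two : ∀ k → N ≡ 2 ^ k → 1# + 1# ≡ 0#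
  characteristic-two k N≡2^k = begin
    1# + 1#                 ≡⟨ cong (1# +_) (+-identityʳ 1#) ⟨
    2 Mult.× 1#             ≡⟨ x↑k≡0⇒x≡0 k (begin
      (2 Mult.× 1#) ↑ k       ≡⟨ ^×1≡×1↑ 2 k ⟨
      (2 ^ k) Mult.× 1#       ≡⟨ cong (Mult._× 1#) N≡2^k ⟨
      N Mult.× 1#             ≡⟨ card×1≡0 ⟩
      0#                      ∎) ⟩
    0#                      ∎

  ifZero : Carrier → Carrier → Carrier → Carrier
  ifZero y u v = if does (y ≟ 0#) then u else v

  ifZero-0 : ∀ {u v} → ifZero 0# u v ≡ u
  ifZero-0 {u} {v} = cong (if_then u else v) (dec-true (0# ≟ 0#) refl)

  ifZero-≢0 : ∀ {y u v} → y ≢ 0# → ifZero y u v ≡ v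
  ifZero-≢0 {y} {u} {v} y≢0 = cong (if_then u else v) (dec-false (y ≟ 0#) y≢0)

  unit : Carrier → Carrier
  unit y = ifZero y 1# y

  unit≢0 : ∀ y → unit y ≢ 0#
  unit≢0 y with y ≟ 0#
  ... | yes refl = λ unit0≡0 → 1≢0 (trans (sym ifZero-0) unit0≡0)
  ... | no  y≢0  = λ unity≡0 → y≢0 (trans (sym (ifZero-≢0 y≢0)) unity≡0)

  ∏≢0 : ∀ {n} (f : Vector Carrier n) → (∀ i → f i ≢ 0#) → ∏.sum f ≢ 0#
  ∏≢0 {zero}  f f≢0 = 1≢0
  ∏≢0 {suc n} f f≢0 = x≢0∧y≢0⇒xy≢0 (f≢0 Fin.zero) (∏≢0 (f ∘ Fin.suc) (f≢0 ∘ Fin.suc))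

  unit-dilation : ∀ a y → a ≢ 0# → unit (a * y) * ifZero y a 1# ≡ a * unit y
  unit-dilation a y a≢0 with y ≟ 0#
  ... | yes refl = begin
    unit (a * 0#) * ifZero 0# a 1#   ≡⟨ cong₂ (λ z w → unit z * w) (zeroʳ a) ifZero-0 ⟩
    unit 0# * a                      ≡⟨ cong (_* a) ifZero-0 ⟩
    1# * a                           ≡⟨ trans (*-identityˡ a) (sym (*-identityʳ a)) ⟩
    a * 1#                           ≡⟨ cong (a *_) (sym ifZero-0) ⟩
    a * unit 0#                      ∎
  ... | no y≢0 = begin
    unit (a * y) * ifZero y a 1#     ≡⟨ cong₂ _*_ (ifZero-≢0 (x≢0∧y≢0⇒xy≢0 a≢0 y≢0)) (ifZero-≢0 y≢0) ⟩
    (a * y) * 1#                     ≡⟨ *-identityʳ (a * y) ⟩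
    a * y                            ≡⟨ cong (a *_) (sym (ifZero-≢0 y≢0)) ⟩
    a * unit y                       ∎

  -- Fermat: y ↦ x * y permutes the field, so ∏ unit (x * y) = ∏ unit y, while
  -- unit (x * y) = x * unit y except at y = 0, which ifZero y x 1# corrects.
  ↑-card : ∀ x → x ↑ N ≡ x
  ↑-card x with x ≟ 0#
  ... | yes refl = 0↑k≡0 (ℕ.≤-<-trans z≤n (Fin.toℕ<n (Inverse.from enum 0#)))
  ... | no x≢0 = sym (*-cancelˡ-nonZero P _ _ (∏≢0 (unit ∘ element) (unit≢0 ∘ element)) (begin
    P * x                                                  ≡⟨ cong₂ _*_ (sum-reindex *-commutativeMonoid enum (dilation x x≢0) unit) (sym ∏ifZero) ⟩
    ∏.sum (unit ∘ (x *_) ∘ element) * ∏.sum (λ i → ifZero (element i) x 1#)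
                                                           ≡⟨ sym (∏.∑-distrib-+ (unit ∘ (x *_) ∘ element) _) ⟩
    ∏.sum (λ i → unit (x * element i) * ifZero (element i) x 1#)
                                                           ≡⟨ ∏.sum-cong-≗ {N} (λ i → unit-dilation x (element i) x≢0) ⟩
    ∏.sum (λ i → x * unit (element i))                     ≡⟨ ∏.∑-distrib-+ (replicate N x) (unit ∘ element) ⟩
    ∏.sum (replicate N x) * P                              ≡⟨ cong (_* P) (trans (∏.sum-replicate N) (sym (↑≡^ x N))) ⟩
    x ↑ N * P                                              ≡⟨ *-comm (x ↑ N) P ⟩
    P * x ↑ N                                              ∎))
    where
    P = ∏.sum (unit ∘ element)
    0-index : Fin N
    0-index = Inverse.from enum 0#
    ∏ifZero : ∏.sum (λ i → ifZero (element i) x 1#) ≡ x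
    ∏ifZero = trans (sum-single *-commutativeMonoid _ 0-index others)
                    (trans (cong (λ y → ifZero y x 1#) (Inverse.strictlyInverseˡ enum 0#)) ifZero-0)
      where
      others : ∀ j → j ≢ 0-index → ifZero (element j) x 1# ≡ 1#
      others j j≢0-index = ifZero-≢0 (λ ej≡0 → j≢0-index
        (trans (sym (Inverse.strictlyInverseʳ enum j)) (cong (Inverse.from enum) ej≡0)))

  elements : List Carrier
  elements = List.tabulate element

  elements-unique : Unique elements
  elements-unique = Unique.tabulate⁺ (Injection.injective (↔⇒↣ enum))

  ∈-elements : ∀ x → x ∈ₗ elements
  ∈-elements x = subst (_∈ₗ elements) (Inverse.strictlyInverseˡ enum x)
                       (Membership.∈-tabulate⁺ (Inverse.from enum x))

  length-elements : length elements ≡ N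
  length-elements = List.length-tabulate element

  ∀-elements : ∀ {P : Carrier → Set} → (∀ i → P (element i)) → ∀ x → P x
  ∀-elements {P} P∘element x = subst P (Inverse.strictlyInverseˡ enum x) (P∘element (Inverse.from enum x))

  module _ (f : Carrier → Carrier) where

    kernel : List Carrier
    kernel = List.filter (λ y → f y ≟ 0#) elements

    kernel-unique : Unique kernel
    kernel-unique = Unique.filter⁺ (λ y → f y ≟ 0#) elements-unique

    ∈-kernel⁺ : ∀ {k} → f k ≡ 0# → k ∈ₗ kernel
    ∈-kernel⁺ {k} = Membership.∈-filter⁺ (λ y → f y ≟ 0#) (∈-elements k)

    ∈-kernel⁻ : ∀ {k} → k ∈ₗ kernel → f k ≡ 0#
    ∈-kernel⁻ = proj₂ ∘ Membership.∈-filter⁻ (λ y → f y ≟ 0#) {xs = elements}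

    hasPreimage? : ∀ w → Dec (Any (λ y → f y ≡ w) elements)
    hasPreimage? w = Any.any? (λ y → f y ≟ w) elements

    hasPreimage : ∀ y → Any (λ z → f z ≡ f y) elements
    hasPreimage y = Any.map (λ y≡z → cong f (sym y≡z)) (∈-elements y)

    image : List Carrier
    image = List.filter hasPreimage? elements

    image-unique : Unique image
    image-unique = Unique.filter⁺ hasPreimage? elements-unique

    ∈-image⁺ : ∀ y → f y ∈ₗ image
    ∈-image⁺ y = Membership.∈-filter⁺ hasPreimage? (∈-elements (f y)) (hasPreimage y)

    ∈-image⁻ : ∀ {w} → w ∈ₗ image → ∃ λ y → f y ≡ w
    ∈-image⁻ = Any.satisfied ∘ proj₂ ∘ Membership.∈-filter⁻ hasPreimage? {xs = elements}

    -- a preimage of w, or the junk value w if there is none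
    section : Carrier → Carrier
    section w with hasPreimage? w
    ... | yes ∃y = proj₁ (Any.satisfied ∃y)
    ... | no  _  = w

    f∘section : ∀ y → f (section (f y)) ≡ f y
    f∘section y with hasPreimage? (f y)
    ... | yes ∃z = proj₂ (Any.satisfied ∃z)
    ... | no  ∄z = contradiction (hasPreimage y) ∄z

    kernelPart : Carrier → Carrier
    kernelPart y = y - section (f y)

    f∘kernelPart : (∀ x y → f (x + y) ≡ f x + f y) → ∀ y → f (kernelPart y) ≡ 0#
    f∘kernelPart f-homo y = ∙-cancelʳ (f y) _ _ (begin
      f (kernelPart y) + f y                        ≡⟨ cong (f (kernelPart y) +_) (f∘section y) ⟨
      f (kernelPart y) + f (section (f y))          ≡⟨ f-homo _ _ ⟨
      f (kernelPart y + section (f y))              ≡⟨ cong f (x-y+y≡x y (section (f y))) ⟩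
      f y                                           ≡⟨ +-identityˡ (f y) ⟨
      0# + f y                                      ∎)

    card≤image*kernel : (∀ x y → f (x + y) ≡ f x + f y) → N ≤ length image ℕ.* length kernel
    card≤image*kernel f-homo = Fin.injective⇒≤ {f = encode} encode-injective
      where
      imageIndex : Carrier → Fin (length image)
      imageIndex y = Any.index (∈-image⁺ y)
      kernelIndex : Carrier → Fin (length kernel)
      kernelIndex y = Any.index (∈-kernel⁺ (f∘kernelPart f-homo y))
      -- y = kernelPart y + section (f y) is recovered from the pair
      encode : Fin N → Fin (length image ℕ.* length kernel)
      encode i = Fin.combine (imageIndex (element i)) (kernelIndex (element i))
      encode-injective : ∀ {i j} → encode i ≡ encode j → i ≡ j
      encode-injective {i} {j} eq = Injection.injective (↔⇒↣ enum) (begin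
        element i                                            ≡⟨ x-y+y≡x (element i) _ ⟨
        kernelPart (element i) + section (f (element i))     ≡⟨ cong₂ (λ k w → k + section w) kernelPart≡ f≡ ⟩
        kernelPart (element j) + section (f (element j))     ≡⟨ x-y+y≡x (element j) _ ⟩
        element j                                            ∎)
        where
        indices≡ : imageIndex (element i) ≡ imageIndex (element j) × kernelIndex (element i) ≡ kernelIndex (element j)
        indices≡ = Fin.combine-injective _ _ _ _ eq
        f≡ : f (element i) ≡ f (element j)
        f≡ = SetoidMembership.index-injective (setoid Carrier) (∈-image⁺ _) (∈-image⁺ _) (proj₁ indices≡)
        kernelPart≡ : kernelPart (element i) ≡ kernelPart (element j)
        kernelPart≡ = SetoidMembership.index-injective (setoid Carrier) (∈-kernel⁺ _) (∈-kernel⁺ _) (proj₂ indices≡)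

module Polynomials {N : ℕ} (F : FiniteField N) where
  open FiniteField F
  open FieldProperties F

  horner : List Carrier → Carrier → Carrier
  horner []       x = 0#
  horner (c ∷ cs) x = c + x * horner cs x

  divide : Carrier → List Carrier → List Carrier × Carrier
  divide r []           = [] , 0#
  divide r (c ∷ [])     = [] , c
  divide r (c ∷ d ∷ cs) with divide r (d ∷ cs)
  ... | q , ρ = ρ ∷ q , c + r * ρ

  horner-divide : ∀ r p x → let q , ρ = divide r p in horner p x ≡ (x - r) * horner q x + ρ
  horner-divide r []           x = sym (trans (+-identityʳ _) (zeroʳ _))
  horner-divide r (c ∷ [])     x = begin
    c + x * 0#                   ≡⟨ cong (c +_) (zeroʳ x) ⟩
    c + 0#                       ≡⟨ +-comm c 0# ⟩
    0# + c                       ≡⟨ cong (_+ c) (sym (zeroʳ (x - r))) ⟩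
    (x - r) * 0# + c             ∎
  horner-divide r (c ∷ d ∷ cs) x with divide r (d ∷ cs) | horner-divide r (d ∷ cs) x
  ... | q , ρ | eq = begin
    c + x * horner (d ∷ cs) x                ≡⟨ cong (λ t → c + x * t) eq ⟩
    c + x * ((x - r) * Q + ρ)                ≡⟨ cong (λ t → c + t * ((x - r) * Q + ρ)) x≡x-r+r ⟩
    c + (x - r + r) * ((x - r) * Q + ρ)      ≡⟨ solve 5 (λ c d r Q ρ → (c :+ (d :+ r) :* (d :* Q :+ ρ)) := (d :* (ρ :+ (d :+ r) :* Q) :+ (c :+ r :* ρ))) refl c (x - r) r Q ρ ⟩
    (x - r) * (ρ + (x - r + r) * Q) + (c + r * ρ) ≡⟨ cong (λ t → (x - r) * (ρ + t * Q) + (c + r * ρ)) (sym x≡x-r+r) ⟩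
    (x - r) * (ρ + x * Q) + (c + r * ρ)      ∎
    where
    Q = horner q x
    x≡x-r+r : x ≡ x - r + r
    x≡x-r+r = sym (x-y+y≡x x r)

  quotient : Carrier → List Carrier → List Carrier
  quotient r p = proj₁ (divide r p)

  remainder : Carrier → List Carrier → Carrier
  remainder r p = proj₂ (divide r p)

  length-quotient : ∀ r p → length (quotient r p) ≡ ℕ.pred (length p)
  length-quotient r []           = refl
  length-quotient r (c ∷ [])     = refl
  length-quotient r (c ∷ d ∷ cs) with divide r (d ∷ cs) | length-quotient r (d ∷ cs)
  ... | q , ρ | eq = cong suc eq

  zero-quotient : ∀ r p → All (_≡ 0#) (quotient r p) → remainder r p ≡ 0# → All (_≡ 0#) p
  zero-quotient r []           _ _   = []
  zero-quotient r (c ∷ [])     _ c≡0 = c≡0 ∷ []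
  zero-quotient r (c ∷ d ∷ cs) with divide r (d ∷ cs) | zero-quotient r (d ∷ cs)
  ... | q , ρ | ih = λ { (ρ≡0 ∷ q≡0) c+rρ≡0 → c≡0 ρ≡0 c+rρ≡0 ∷ ih q≡0 ρ≡0 }
    where
    c≡0 : ρ ≡ 0# → c + r * ρ ≡ 0# → c ≡ 0#
    c≡0 ρ≡0 c+rρ≡0 = trans (sym (trans (cong (λ t → c + r * t) ρ≡0) (trans (cong (c +_) (zeroʳ r)) (+-identityʳ c)))) c+rρ≡0

  remainder-at-root : ∀ r p → horner p r ≡ remainder r p
  remainder-at-root r p = begin
    horner p r                                      ≡⟨ horner-divide r p r ⟩
    (r - r) * horner (quotient r p) r + remainder r p ≡⟨ cong (λ t → t * horner (quotient r p) r + remainder r p) (-‿inverseʳ r) ⟩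
    0# * horner (quotient r p) r + remainder r p    ≡⟨ cong (_+ remainder r p) (zeroˡ _) ⟩
    0# + remainder r p                              ≡⟨ +-identityˡ _ ⟩
    remainder r p                                   ∎

  quotient-root : ∀ {r s} p → r ≢ s → horner p r ≡ 0# → horner p s ≡ 0# → horner (quotient r p) s ≡ 0#
  quotient-root {r} {s} p r≢s pr≡0 ps≡0 =
    fromInj₂ (λ s-r≡0 → contradiction (sym (x∙y⁻¹≈ε⇒x≈y s r s-r≡0)) r≢s) (xy≡0⇒x≡0∨y≡0 (begin
      (s - r) * horner (quotient r p) s                 ≡⟨ +-identityʳ _ ⟨
      (s - r) * horner (quotient r p) s + 0#            ≡⟨ cong ((s - r) * horner (quotient r p) s +_) (trans (sym pr≡0) (remainder-at-root r p)) ⟩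
      (s - r) * horner (quotient r p) s + remainder r p ≡⟨ horner-divide r p s ⟨
      horner p s                                        ≡⟨ ps≡0 ⟩
      0#                                                ∎))

  roots⇒zero : ∀ rs p → Unique rs → All (λ r → horner p r ≡ 0#) rs → length p ≤ length rs → All (_≡ 0#) p
  roots⇒zero []       []      _                _             _   = []
  roots⇒zero (r ∷ rs) p (r∉rs ∷ rs-unique) (pr≡0 ∷ prs≡0) len =
    zero-quotient r p (roots⇒zero rs (quotient r p) rs-unique qrs≡0 len-q)
                      (trans (sym (remainder-at-root r p)) pr≡0)
    where
    qrs≡0 : All (λ s → horner (quotient r p) s ≡ 0#) rs
    qrs≡0 = All.zipWith (λ (r≢s , ps≡0) → quotient-root p r≢s pr≡0 ps≡0) (r∉rs , prs≡0)
    len-q : length (quotient r p) ≤ length rs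
    len-q = subst (_≤ length rs) (sym (length-quotient r p)) (ℕ.pred-mono-≤ len)

  -- Sparse polynomials: exponents may repeat, and coeff adds up the coefficients of
  -- equal exponents. The root bound is proved on dense coefficient lists (horner).
  infix 9 _X^_
  record Monomial : Set where
    constructor _X^_
    field
      coefficient : Carrier
      exponent    : ℕ
  open Monomial public

  Polynomial : Set
  Polynomial = List Monomial

  ⟦_⟧ : Polynomial → Carrier → Carrier
  ⟦ []         ⟧ x = 0#
  ⟦ c X^ e ∷ p ⟧ x = c * x ↑ e + ⟦ p ⟧ x

  coeff : Polynomial → ℕ → Carrier
  coeff []           d = 0#
  coeff (c X^ e ∷ p) d = (if does (e ℕ.≟ d) then c else 0#) + coeff p d

  scale : Carrier → Polynomial → Polynomial
  scale a = List.map λ { (c X^ e) → (a * c) X^ e }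

  ⟦++⟧ : ∀ p q x → ⟦ p ++ q ⟧ x ≡ ⟦ p ⟧ x + ⟦ q ⟧ x
  ⟦++⟧ []           q x = sym (+-identityˡ _)
  ⟦++⟧ (c X^ e ∷ p) q x = trans (cong (c * x ↑ e +_) (⟦++⟧ p q x)) (sym (+-assoc _ _ _))

  coeff-++ : ∀ p q d → coeff (p ++ q) d ≡ coeff p d + coeff q d
  coeff-++ []           q d = sym (+-identityˡ _)
  coeff-++ (c X^ e ∷ p) q d = trans (cong (_ +_) (coeff-++ p q d)) (sym (+-assoc _ _ _))

  ⟦scale⟧ : ∀ a p x → ⟦ scale a p ⟧ x ≡ a * ⟦ p ⟧ x
  ⟦scale⟧ a []           x = sym (zeroʳ a)
  ⟦scale⟧ a (c X^ e ∷ p) x = begin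
    a * c * x ↑ e + ⟦ scale a p ⟧ x   ≡⟨ cong₂ _+_ (*-assoc a c _) (⟦scale⟧ a p x) ⟩
    a * (c * x ↑ e) + a * ⟦ p ⟧ x     ≡⟨ distribˡ a _ _ ⟨
    a * (c * x ↑ e + ⟦ p ⟧ x)         ∎

  coeff-scale : ∀ a p d → coeff (scale a p) d ≡ a * coeff p d
  coeff-scale a []           d = sym (zeroʳ a)
  coeff-scale a (c X^ e ∷ p) d = trans (cong₂ _+_ (if-scale (does (e ℕ.≟ d))) (coeff-scale a p d)) (sym (distribˡ a _ _))
    where
    if-scale : ∀ b → (if b then a * c else 0#) ≡ a * (if b then c else 0#)
    if-scale true  = refl
    if-scale false = sym (zeroʳ a)

  coeff-hit : ∀ c {e d} p → e ≡ d → coeff (c X^ e ∷ p) d ≡ c + coeff p d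
  coeff-hit c {e} {d} p e≡d = cong (λ b → (if b then c else 0#) + coeff p d) (dec-true (e ℕ.≟ d) e≡d)

  coeff-miss : ∀ c {e d} p → e ≢ d → coeff (c X^ e ∷ p) d ≡ coeff p d
  coeff-miss c {e} {d} p e≢d =
    trans (cong (λ b → (if b then c else 0#) + coeff p d) (dec-false (e ℕ.≟ d) e≢d)) (+-identityˡ _)

  coeff-absent : ∀ p {d} → All ((_≢ d) ∘ exponent) p → coeff p d ≡ 0#
  coeff-absent []           []               = refl
  coeff-absent (c X^ e ∷ p) (e≢d ∷ p-absent) = trans (coeff-miss c p e≢d) (coeff-absent p p-absent)

  coeff-single : ∀ p c {d} q → All ((_≢ d) ∘ exponent) p → All ((_≢ d) ∘ exponent) q → coeff (p ++ c X^ d ∷ q) d ≡ c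
  coeff-single p c {d} q p-absent q-absent = begin
    coeff (p ++ c X^ d ∷ q) d            ≡⟨ coeff-++ p (c X^ d ∷ q) d ⟩
    coeff p d + coeff (c X^ d ∷ q) d     ≡⟨ cong₂ _+_ (coeff-absent p p-absent) (coeff-hit c q refl) ⟩
    0# + (c + coeff q d)                 ≡⟨ trans (+-identityˡ _) (cong (c +_) (coeff-absent q q-absent)) ⟩
    c + 0#                               ≡⟨ +-identityʳ c ⟩
    c                                    ∎

  horner-zeros : ∀ B x → horner (List.applyUpTo (λ _ → 0#) B) x ≡ 0#
  horner-zeros zero    x = refl
  horner-zeros (suc B) x = begin
    0# + x * horner (List.applyUpTo (λ _ → 0#) B) x   ≡⟨ cong (λ t → 0# + x * t) (horner-zeros B x) ⟩
    0# + x * 0#                                       ≡⟨ trans (+-identityˡ _) (zeroʳ x) ⟩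
    0#                                                ∎

  horner-applyUpTo-+ : ∀ B f g x → horner (List.applyUpTo (λ d → f d + g d) B) x
                                   ≡ horner (List.applyUpTo f B) x + horner (List.applyUpTo g B) x
  horner-applyUpTo-+ zero    f g x = sym (+-identityˡ 0#)
  horner-applyUpTo-+ (suc B) f g x = begin
    (f 0 + g 0) + x * horner (List.applyUpTo (λ d → f (suc d) + g (suc d)) B) x
      ≡⟨ cong (λ t → (f 0 + g 0) + x * t) (horner-applyUpTo-+ B (f ∘ suc) (g ∘ suc) x) ⟩
    (f 0 + g 0) + x * (Hf + Hg)
      ≡⟨ solve 5 (λ f g x F G → ((f :+ g) :+ x :* (F :+ G)) := ((f :+ x :* F) :+ (g :+ x :* G))) refl (f 0) (g 0) x Hf Hg ⟩
    (f 0 + x * Hf) + (g 0 + x * Hg) ∎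
    where
    Hf = horner (List.applyUpTo (f ∘ suc) B) x
    Hg = horner (List.applyUpTo (g ∘ suc) B) x

  horner-monomial : ∀ c e B x → e ℕ.< B → horner (List.applyUpTo (λ d → if does (e ℕ.≟ d) then c else 0#) B) x ≡ c * x ↑ e
  horner-monomial c zero    (suc B) x _ = begin
    c + x * horner (List.applyUpTo (λ _ → 0#) B) x   ≡⟨ cong (λ t → c + x * t) (horner-zeros B x) ⟩
    c + x * 0#                                       ≡⟨ trans (cong (c +_) (zeroʳ x)) (+-identityʳ c) ⟩
    c                                                ≡⟨ *-identityʳ c ⟨
    c * 1#                                           ∎
  horner-monomial c (suc e) (suc B) x (s≤s e<B) = begin
    0# + x * horner (List.applyUpTo (λ d → if does (e ℕ.≟ d) then c else 0#) B) x ≡⟨ cong (λ t → 0# + x * t) (horner-monomial c e B x e<B) ⟩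
    0# + x * (c * x ↑ e)                             ≡⟨ +-identityˡ _ ⟩
    x * (c * x ↑ e)                                  ≡⟨ solve 3 (λ x c X → (x :* (c :* X)) := (c :* (x :* X))) refl x c (x ↑ e) ⟩
    c * (x * x ↑ e)                                  ∎

  horner-dense : ∀ p B x → All ((ℕ._< B) ∘ exponent) p → horner (List.applyUpTo (coeff p) B) x ≡ ⟦ p ⟧ x
  horner-dense []           B x []             = horner-zeros B x
  horner-dense (c X^ e ∷ p) B x (e<B ∷ p-deg) =
    trans (horner-applyUpTo-+ B _ (coeff p) x) (cong₂ _+_ (horner-monomial c e B x e<B) (horner-dense p B x p-deg))

  coeff-vanishes : ∀ p rs → Unique rs → All (λ r → ⟦ p ⟧ r ≡ 0#) rs →
                   All ((ℕ._< length rs) ∘ exponent) p → ∀ d → coeff p d ≡ 0#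
  coeff-vanishes p rs unique roots p-deg d with d ℕ.<? length rs
  ... | yes d<B = All.lookup dense≡0 (Membership.∈-applyUpTo⁺ (coeff p) d<B)
    where
    dense≡0 : All (_≡ 0#) (List.applyUpTo (coeff p) (length rs))
    dense≡0 = roots⇒zero rs _ unique (All.map (λ {r} pr≡0 → trans (horner-dense p _ r p-deg) pr≡0) roots)
                         (ℕ.≤-reflexive (List.length-applyUpTo (coeff p) (length rs)))
  ... | no d≮B = coeff-absent p (All.map (λ e<B e≡d → d≮B (subst (ℕ._< length rs) e≡d e<B)) p-deg)

  roots-bound : ∀ p rs {d e} → Unique rs → All (λ r → ⟦ p ⟧ r ≡ 0#) rs →
                All ((_≤ d) ∘ exponent) p → coeff p e ≢ 0# → length rs ≤ d
  roots-bound p rs {d} {e} unique roots p-deg coeff≢0 with length rs ℕ.≤? d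
  ... | yes rs≤d = rs≤d
  ... | no  rs≰d = contradiction (coeff-vanishes p rs unique roots p-deg′ e) coeff≢0
    where
    p-deg′ : All ((ℕ._< length rs) ∘ exponent) p
    p-deg′ = All.map (λ e≤d → ℕ.≤-<-trans e≤d (ℕ.≰⇒> rs≰d)) p-deg

  coeff-agree : ∀ p q rs → Unique rs → All (λ r → ⟦ p ⟧ r ≡ ⟦ q ⟧ r) rs →
                All ((ℕ._< length rs) ∘ exponent) p → All ((ℕ._< length rs) ∘ exponent) q →
                ∀ d → coeff p d ≡ coeff q d
  coeff-agree p q rs unique agree p-deg q-deg d = x∙y⁻¹≈ε⇒x≈y _ _ (begin
    coeff p d - coeff q d                 ≡⟨ cong (coeff p d +_) (-1*x≈-x (coeff q d)) ⟨
    coeff p d + - 1# * coeff q d          ≡⟨ cong (coeff p d +_) (coeff-scale (- 1#) q d) ⟨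
    coeff p d + coeff (scale (- 1#) q) d  ≡⟨ coeff-++ p (scale (- 1#) q) d ⟨
    coeff (p ++ scale (- 1#) q) d         ≡⟨ coeff-vanishes (p ++ scale (- 1#) q) rs unique roots
                                               (All.++⁺ p-deg (All.map⁺ q-deg)) d ⟩
    0#                                    ∎)
    where
    roots : All (λ r → ⟦ p ++ scale (- 1#) q ⟧ r ≡ 0#) rs
    roots = All.map (λ {r} pr≡qr → begin
      ⟦ p ++ scale (- 1#) q ⟧ r       ≡⟨ ⟦++⟧ p _ r ⟩
      ⟦ p ⟧ r + ⟦ scale (- 1#) q ⟧ r  ≡⟨ cong (⟦ p ⟧ r +_) (trans (⟦scale⟧ (- 1#) q r) (-1*x≈-x _)) ⟩
      ⟦ p ⟧ r - ⟦ q ⟧ r               ≡⟨ x≈y⇒x∙y⁻¹≈ε pr≡qr ⟩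
      0#                              ∎) agree

  toPolynomial : Poly≤3 → Polynomial
  toPolynomial (c₀ ∷ c₁ ∷ c₂ ∷ c₃ ∷ []) = c₀ X^ 0 ∷ c₁ X^ 1 ∷ c₂ X^ 2 ∷ c₃ X^ 3 ∷ []

  toPolynomial-degree : ∀ p → All ((ℕ._< 4) ∘ exponent) (toPolynomial p)
  toPolynomial-degree (c₀ ∷ c₁ ∷ c₂ ∷ c₃ ∷ []) = z<s ∷ s<s z<s ∷ s<s (s<s z<s) ∷ s<s (s<s (s<s z<s)) ∷ []

  eval≡⟦toPolynomial⟧ : ∀ p x → eval p x ≡ ⟦ toPolynomial p ⟧ x
  eval≡⟦toPolynomial⟧ (c₀ ∷ c₁ ∷ c₂ ∷ c₃ ∷ []) x = begin
    c₀ + c₁ * x + c₂ * x ↑ 2 + c₃ * x ↑ 3                     ≡⟨ solve 4 (λ a b c d → (a :+ b :+ c :+ d) := (a :+ (b :+ (c :+ d)))) refl c₀ (c₁ * x) (c₂ * x ↑ 2) (c₃ * x ↑ 3) ⟩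
    c₀ + (c₁ * x + (c₂ * x ↑ 2 + c₃ * x ↑ 3))                 ≡⟨ cong₂ (λ u v → u + (c₁ * v + (c₂ * x ↑ 2 + c₃ * x ↑ 3))) (*-identityʳ c₀) (x↑1≡x x) ⟨
    c₀ * x ↑ 0 + (c₁ * x ↑ 1 + (c₂ * x ↑ 2 + c₃ * x ↑ 3))     ≡⟨ cong (λ t → c₀ * x ↑ 0 + (c₁ * x ↑ 1 + (c₂ * x ↑ 2 + t))) (+-identityʳ _) ⟨
    c₀ * x ↑ 0 + (c₁ * x ↑ 1 + (c₂ * x ↑ 2 + (c₃ * x ↑ 3 + 0#))) ∎

  coeff-toPolynomial : ∀ p (i : Fin 4) → coeff (toPolynomial p) (Fin.toℕ i) ≡ Vec.lookup p i
  coeff-toPolynomial (c₀ ∷ c₁ ∷ c₂ ∷ c₃ ∷ []) 0F =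
    coeff-single [] c₀ {0} (c₁ X^ 1 ∷ c₂ X^ 2 ∷ c₃ X^ 3 ∷ []) [] ((λ ()) ∷ (λ ()) ∷ (λ ()) ∷ [])
  coeff-toPolynomial (c₀ ∷ c₁ ∷ c₂ ∷ c₃ ∷ []) 1F =
    coeff-single (c₀ X^ 0 ∷ []) c₁ {1} (c₂ X^ 2 ∷ c₃ X^ 3 ∷ []) ((λ ()) ∷ []) ((λ ()) ∷ (λ ()) ∷ [])
  coeff-toPolynomial (c₀ ∷ c₁ ∷ c₂ ∷ c₃ ∷ []) 2F =
    coeff-single (c₀ X^ 0 ∷ c₁ X^ 1 ∷ []) c₂ {2} (c₃ X^ 3 ∷ []) ((λ ()) ∷ (λ ()) ∷ []) ((λ ()) ∷ [])
  coeff-toPolynomial (c₀ ∷ c₁ ∷ c₂ ∷ c₃ ∷ []) 3F =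
    coeff-single (c₀ X^ 0 ∷ c₁ X^ 1 ∷ c₂ X^ 2 ∷ []) c₃ {3} [] ((λ ()) ∷ (λ ()) ∷ (λ ()) ∷ []) []

  toPolynomial-injective : ∀ p p′ → (∀ d → coeff (toPolynomial p) d ≡ coeff (toPolynomial p′) d) → p ≡ p′
  toPolynomial-injective p@(_ ∷ _ ∷ _ ∷ _ ∷ []) p′@(_ ∷ _ ∷ _ ∷ _ ∷ []) coeff≡ =
    cong₂ _∷_ (lookup≡ 0F) (cong₂ _∷_ (lookup≡ 1F) (cong₂ _∷_ (lookup≡ 2F) (cong₂ _∷_ (lookup≡ 3F) refl)))
    where
    lookup≡ : ∀ i → Vec.lookup p i ≡ Vec.lookup p′ i
    lookup≡ i = trans (sym (coeff-toPolynomial p i)) (trans (coeff≡ (Fin.toℕ i)) (coeff-toPolynomial p′ i))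

  eval-0 : ∀ p → eval p 0# ≡ Vec.head p
  eval-0 (c₀ ∷ c₁ ∷ c₂ ∷ c₃ ∷ []) = begin
    c₀ + c₁ * 0# + c₂ * 0# ↑ 2 + c₃ * 0# ↑ 3   ≡⟨ cong₂ (λ u v → c₀ + c₁ * 0# + c₂ * u + c₃ * v) (zeroˡ _) (zeroˡ _) ⟩
    c₀ + c₁ * 0# + c₂ * 0# + c₃ * 0#           ≡⟨ cong₂ _+_ (cong₂ _+_ (cong (c₀ +_) (zeroʳ c₁)) (zeroʳ c₂)) (zeroʳ c₃) ⟩
    c₀ + 0# + 0# + 0#                          ≡⟨ trans (+-identityʳ _) (trans (+-identityʳ _) (+-identityʳ c₀)) ⟩
    c₀                                         ∎

  cubic-determined : ∀ p₁ p₂ (xs : List Carrier) → Unique xs → 4 ≤ length xs →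
                     All (λ x → eval p₁ x ≡ eval p₂ x) xs → p₁ ≡ p₂
  cubic-determined p₁ p₂ xs unique 4≤∣xs∣ agree =
    toPolynomial-injective p₁ p₂ (coeff-agree (toPolynomial p₁) (toPolynomial p₂) xs unique agree′ (degree p₁) (degree p₂))
    where
    agree′ : All (λ x → ⟦ toPolynomial p₁ ⟧ x ≡ ⟦ toPolynomial p₂ ⟧ x) xs
    agree′ = All.map (λ {x} p₁x≡p₂x → trans (sym (eval≡⟦toPolynomial⟧ p₁ x)) (trans p₁x≡p₂x (eval≡⟦toPolynomial⟧ p₂ x))) agree
    degree : ∀ p → All ((ℕ._< length xs) ∘ exponent) (toPolynomial p)
    degree p = All.map (λ e<4 → ℕ.<-≤-trans e<4 4≤∣xs∣) (toPolynomial-degree p)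

HasCharacteristicTwo : ∀ {N} → FiniteField N → Set
HasCharacteristicTwo F = 1# + 1# ≡ 0#
  where
  open FiniteField F

module CharacteristicTwo {N : ℕ} (F : FiniteField N) (1+1≡0 : HasCharacteristicTwo F) where
  open FiniteField F
  open FieldProperties F
  open Polynomials F

  x+x≡0 : ∀ x → x + x ≡ 0#
  x+x≡0 x = begin
    x + x               ≡⟨ cong₂ _+_ (*-identityˡ x) (*-identityˡ x) ⟨
    1# * x + 1# * x     ≡⟨ distribʳ x 1# 1# ⟨
    (1# + 1#) * x       ≡⟨ cong (_* x) 1+1≡0 ⟩
    0# * x              ≡⟨ zeroˡ x ⟩
    0#                  ∎

  x+y≡0⇒x≡y : ∀ {x y} → x + y ≡ 0# → x ≡ y
  x+y≡0⇒x≡y {x} {y} x+y≡0 = begin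
    x                ≡⟨ +-identityʳ x ⟨
    x + 0#           ≡⟨ cong (x +_) (x+x≡0 y) ⟨
    x + (y + y)      ≡⟨ +-assoc x y y ⟨
    (x + y) + y      ≡⟨ cong (_+ y) x+y≡0 ⟩
    0# + y           ≡⟨ +-identityˡ y ⟩
    y                ∎

  x+y≡z⇒y≡x+z : ∀ {x y z} → x + y ≡ z → y ≡ x + z
  x+y≡z⇒y≡x+z {x} {y} {z} x+y≡z = x+y≡0⇒x≡y (begin
    y + (x + z)      ≡⟨ solve 3 (λ x y z → (y :+ (x :+ z)) := ((x :+ y) :+ z)) refl x y z ⟩
    (x + y) + z      ≡⟨ cong (_+ z) x+y≡z ⟩
    z + z            ≡⟨ x+x≡0 z ⟩
    0#               ∎)

  frobenius-square : ∀ x y → (x + y) ↑ 2 ≡ x ↑ 2 + y ↑ 2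
  frobenius-square x y = begin
    (x + y) ↑ 2                         ≡⟨ x↑2≡x*x (x + y) ⟩
    (x + y) * (x + y)                   ≡⟨ solve 2 (λ x y → ((x :+ y) :* (x :+ y)) := ((x :* x :+ y :* y) :+ (x :* y :+ x :* y))) refl x y ⟩
    (x * x + y * y) + (x * y + x * y)   ≡⟨ cong (x * x + y * y +_) (x+x≡0 (x * y)) ⟩
    (x * x + y * y) + 0#                ≡⟨ +-identityʳ _ ⟩
    x * x + y * y                       ≡⟨ cong₂ _+_ (x↑2≡x*x x) (x↑2≡x*x y) ⟨
    x ↑ 2 + y ↑ 2                       ∎

  frobenius : ∀ k x y → (x + y) ↑ (2 ^ k) ≡ x ↑ (2 ^ k) + y ↑ (2 ^ k)
  frobenius zero    x y = trans (x↑1≡x (x + y)) (sym (cong₂ _+_ (x↑1≡x x) (x↑1≡x y)))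
  frobenius (suc k) x y = begin
    (x + y) ↑ (2 ℕ.* 2 ^ k)                ≡⟨ ↑-assocʳ (x + y) 2 (2 ^ k) ⟨
    ((x + y) ↑ 2) ↑ (2 ^ k)                ≡⟨ cong (_↑ (2 ^ k)) (frobenius-square x y) ⟩
    (x ↑ 2 + y ↑ 2) ↑ (2 ^ k)              ≡⟨ frobenius k (x ↑ 2) (y ↑ 2) ⟩
    (x ↑ 2) ↑ (2 ^ k) + (y ↑ 2) ↑ (2 ^ k)  ≡⟨ cong₂ _+_ (↑-assocʳ x 2 (2 ^ k)) (↑-assocʳ y 2 (2 ^ k)) ⟩
    x ↑ (2 ℕ.* 2 ^ k) + y ↑ (2 ℕ.* 2 ^ k)  ∎

  hsum-homo-+ : ∀ k x y → hsum k (x + y) ≡ hsum k x + hsum k y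
  hsum-homo-+ zero    x y = sym (+-identityˡ 0#)
  hsum-homo-+ (suc k) x y = begin
    (x + y) ↑ (2 ^ k) + hsum k (x + y)                        ≡⟨ cong₂ _+_ (frobenius k x y) (hsum-homo-+ k x y) ⟩
    (x ↑ (2 ^ k) + y ↑ (2 ^ k)) + (hsum k x + hsum k y)       ≡⟨ solve 4 (λ a b c d → ((a :+ b) :+ (c :+ d)) := ((a :+ c) :+ (b :+ d))) refl _ _ _ _ ⟩
    (x ↑ (2 ^ k) + hsum k x) + (y ↑ (2 ^ k) + hsum k y)       ∎

  hsum-square : ∀ k y → hsum k y ↑ 2 + hsum k y ≡ y ↑ (2 ^ k) + y
  hsum-square zero    y = begin
    0# ↑ 2 + 0#     ≡⟨ trans (+-identityʳ _) (zeroˡ _) ⟩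
    0#              ≡⟨ x+x≡0 y ⟨
    y + y           ≡⟨ cong (_+ y) (x↑1≡x y) ⟨
    y ↑ 1 + y       ∎
  hsum-square (suc k) y = begin
    (P + H) ↑ 2 + (P + H)            ≡⟨ cong (_+ (P + H)) (frobenius-square P H) ⟩
    (P ↑ 2 + H ↑ 2) + (P + H)        ≡⟨ solve 4 (λ A B P H → ((A :+ B) :+ (P :+ H)) := (A :+ (P :+ (B :+ H)))) refl (P ↑ 2) (H ↑ 2) P H ⟩
    P ↑ 2 + (P + (H ↑ 2 + H))        ≡⟨ cong (λ t → P ↑ 2 + (P + t)) (hsum-square k y) ⟩
    P ↑ 2 + (P + (P + y))            ≡⟨ cong (P ↑ 2 +_) (+-assoc P P y) ⟨
    P ↑ 2 + ((P + P) + y)            ≡⟨ cong (λ t → P ↑ 2 + (t + y)) (x+x≡0 P) ⟩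
    P ↑ 2 + (0# + y)                 ≡⟨ cong (P ↑ 2 +_) (+-identityˡ y) ⟩
    P ↑ 2 + y                        ≡⟨ cong (_+ y) (↑-assocʳ y (2 ^ k) 2) ⟩
    y ↑ (2 ^ k ℕ.* 2) + y            ≡⟨ cong (λ t → y ↑ t + y) (ℕ.*-comm (2 ^ k) 2) ⟩
    y ↑ (2 ℕ.* 2 ^ k) + y            ∎
    where
    P = y ↑ (2 ^ k)
    H = hsum k y

  hsum-0 : ∀ k → hsum k 0# ≡ 0#
  hsum-0 zero    = refl
  hsum-0 (suc k) = trans (cong₂ _+_ (0↑k≡0 (ℕ.m^n>0 2 k)) (hsum-0 k)) (+-identityˡ 0#)

  frobeniusᵖ : ℕ → Polynomial → Polynomial
  frobeniusᵖ i = List.map λ { (c X^ e) → (c ↑ 2 ^ i) X^ (e ℕ.* 2 ^ i) }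

  ⟦frobeniusᵖ⟧ : ∀ i p x → ⟦ frobeniusᵖ i p ⟧ x ≡ ⟦ p ⟧ x ↑ (2 ^ i)
  ⟦frobeniusᵖ⟧ i []           x = sym (0↑k≡0 (ℕ.m^n>0 2 i))
  ⟦frobeniusᵖ⟧ i (c X^ e ∷ p) x = begin
    c ↑ P * x ↑ (e ℕ.* P) + ⟦ frobeniusᵖ i p ⟧ x  ≡⟨ cong₂ _+_ (cong (c ↑ P *_) (↑-assocʳ x e P)) (sym (⟦frobeniusᵖ⟧ i p x)) ⟨
    c ↑ P * (x ↑ e) ↑ P + ⟦ p ⟧ x ↑ P             ≡⟨ cong (_+ ⟦ p ⟧ x ↑ P) (↑-distrib-* c (x ↑ e) P) ⟨
    (c * x ↑ e) ↑ P + ⟦ p ⟧ x ↑ P                 ≡⟨ frobenius i _ _ ⟨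
    (c * x ↑ e + ⟦ p ⟧ x) ↑ P                     ∎
    where
    P = 2 ^ i

  hsumᵖ : ℕ → Polynomial → Polynomial
  hsumᵖ zero    p = []
  hsumᵖ (suc k) p = frobeniusᵖ k p ++ hsumᵖ k p

  ⟦hsumᵖ⟧ : ∀ k p x → ⟦ hsumᵖ k p ⟧ x ≡ hsum k (⟦ p ⟧ x)
  ⟦hsumᵖ⟧ zero    p x = refl
  ⟦hsumᵖ⟧ (suc k) p x = trans (⟦++⟧ (frobeniusᵖ k p) (hsumᵖ k p) x) (cong₂ _+_ (⟦frobeniusᵖ⟧ k p x) (⟦hsumᵖ⟧ k p x))

  frobeniusᵖ-degree : ∀ {E} i p → All ((_≤ E) ∘ exponent) p → All ((_≤ E ℕ.* 2 ^ i) ∘ exponent) (frobeniusᵖ i p)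
  frobeniusᵖ-degree i p = All.map⁺ ∘ All.map (λ e≤E → ℕ.*-mono-≤ e≤E ℕ.≤-refl)

  hsumᵖ-degree : ∀ {E} k p → All ((_≤ E) ∘ exponent) p → All ((_≤ E ℕ.* 2 ^ k) ∘ exponent) (hsumᵖ (suc k) p)
  hsumᵖ-degree zero        p p-deg = All.++⁺ (frobeniusᵖ-degree 0 p p-deg) []
  hsumᵖ-degree {E} (suc k) p p-deg = All.++⁺ (frobeniusᵖ-degree (suc k) p p-deg)
    (All.map (λ e≤ → ℕ.≤-trans e≤ (ℕ.*-monoʳ-≤ E (ℕ.^-monoʳ-≤ 2 (ℕ.n≤1+n k)))) (hsumᵖ-degree k p p-deg))

  coeff-hsumᵖ-low : ∀ k p {d} → 0 ℕ.< d → d ℕ.< 4 → coeff (hsumᵖ (2 ℕ.+ k) p) d ≡ coeff (hsumᵖ 2 p) d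
  coeff-hsumᵖ-low zero    p         0<d d<4 = refl
  coeff-hsumᵖ-low (suc k) p {d} 0<d d<4 = begin
    coeff (frobeniusᵖ (2 ℕ.+ k) p ++ hsumᵖ (2 ℕ.+ k) p) d               ≡⟨ coeff-++ (frobeniusᵖ (2 ℕ.+ k) p) _ d ⟩
    coeff (frobeniusᵖ (2 ℕ.+ k) p) d + coeff (hsumᵖ (2 ℕ.+ k) p) d     ≡⟨ cong₂ _+_ (coeff-absent _ (absent p)) (coeff-hsumᵖ-low k p 0<d d<4) ⟩
    0# + coeff (hsumᵖ 2 p) d                                            ≡⟨ +-identityˡ _ ⟩
    coeff (hsumᵖ 2 p) d                                                 ∎
    where
    avoids : ∀ e → e ℕ.* 2 ^ (2 ℕ.+ k) ≢ d
    avoids zero    = ℕ.<⇒≢ 0<d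
    avoids (suc e) = ℕ.>⇒≢ (ℕ.<-≤-trans d<4 (ℕ.≤-trans (ℕ.^-monoʳ-≤ 2 {2} {2 ℕ.+ k} (s≤s (s≤s z≤n))) (ℕ.m≤n*m _ (suc e))))
    absent : ∀ q → All ((_≢ d) ∘ exponent) (frobeniusᵖ (2 ℕ.+ k) q)
    absent []           = []
    absent (c X^ e ∷ q) = avoids e ∷ absent q

  coeff-hsumᵖ-high : ∀ c {k j} → k ≤ j → coeff (hsumᵖ k (c X^ 1 ∷ [])) (2 ^ j) ≡ 0#
  coeff-hsumᵖ-high c {zero}      _   = refl
  coeff-hsumᵖ-high c {suc k} {j} k<j =
    trans (coeff-miss _ (hsumᵖ k (c X^ 1 ∷ [])) (ℕ.<⇒≢ (subst (ℕ._< 2 ^ j) (sym (ℕ.*-identityˡ (2 ^ k))) (ℕ.^-monoʳ-< 2 ℕ.≤-refl k<j))))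
          (coeff-hsumᵖ-high c (ℕ.<⇒≤ k<j))

  coeff-hsumᵖ-monomial : ∀ c {k i} → i ℕ.< k → coeff (hsumᵖ k (c X^ 1 ∷ [])) (2 ^ i) ≡ c ↑ (2 ^ i)
  coeff-hsumᵖ-monomial c {suc k} {i} i<1+k with i ℕ.≟ k
  ... | yes refl = trans (coeff-hit _ (hsumᵖ i (c X^ 1 ∷ [])) (ℕ.*-identityˡ (2 ^ i)))
                         (trans (cong (c ↑ 2 ^ i +_) (coeff-hsumᵖ-high c {i} ℕ.≤-refl)) (+-identityʳ _))
  ... | no  i≢k  = trans (coeff-miss _ (hsumᵖ k (c X^ 1 ∷ [])) (ℕ.>⇒≢ (subst (2 ^ i ℕ.<_) (sym (ℕ.*-identityˡ (2 ^ k))) (ℕ.^-monoʳ-< 2 ℕ.≤-refl i<k))))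
                         (coeff-hsumᵖ-monomial c i<k)
    where
    i<k : i ℕ.< k
    i<k = ℕ.≤∧≢⇒< (ℕ.s≤s⁻¹ i<1+k) i≢k

  coeff-hsum₂-x : ∀ c₀ c₁ c₂ c₃ → coeff (hsumᵖ 2 (toPolynomial (c₀ ∷ c₁ ∷ c₂ ∷ c₃ ∷ []))) 1 ≡ c₁ ↑ 1
  coeff-hsum₂-x c₀ c₁ c₂ c₃ =
    coeff-single ((c₀ ↑ 2) X^ 0 ∷ (c₁ ↑ 2) X^ 2 ∷ (c₂ ↑ 2) X^ 4 ∷ (c₃ ↑ 2) X^ 6 ∷ (c₀ ↑ 1) X^ 0 ∷ []) (c₁ ↑ 1) {1}
                 ((c₂ ↑ 1) X^ 2 ∷ (c₃ ↑ 1) X^ 3 ∷ []) ((λ ()) ∷ (λ ()) ∷ (λ ()) ∷ (λ ()) ∷ (λ ()) ∷ []) ((λ ()) ∷ (λ ()) ∷ [])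

  coeff-hsum₂-x² : ∀ c₀ c₁ c₂ c₃ → coeff (hsumᵖ 2 (toPolynomial (c₀ ∷ c₁ ∷ c₂ ∷ c₃ ∷ []))) 2 ≡ c₁ ↑ 2 + c₂ ↑ 1
  coeff-hsum₂-x² c₀ c₁ c₂ c₃ = trans (coeff-++ (frobeniusᵖ 1 p) (frobeniusᵖ 0 p ++ []) 2) (cong₂ _+_
    (coeff-single ((c₀ ↑ 2) X^ 0 ∷ []) (c₁ ↑ 2) {2} ((c₂ ↑ 2) X^ 4 ∷ (c₃ ↑ 2) X^ 6 ∷ []) ((λ ()) ∷ []) ((λ ()) ∷ (λ ()) ∷ []))
    (coeff-single ((c₀ ↑ 1) X^ 0 ∷ (c₁ ↑ 1) X^ 1 ∷ []) (c₂ ↑ 1) {2} ((c₃ ↑ 1) X^ 3 ∷ []) ((λ ()) ∷ (λ ()) ∷ []) ((λ ()) ∷ [])))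
    where
    p : Polynomial
    p = toPolynomial (c₀ ∷ c₁ ∷ c₂ ∷ c₃ ∷ [])

  coeff-hsum₂-x³ : ∀ c₀ c₁ c₂ c₃ → coeff (hsumᵖ 2 (toPolynomial (c₀ ∷ c₁ ∷ c₂ ∷ c₃ ∷ []))) 3 ≡ c₃ ↑ 1
  coeff-hsum₂-x³ c₀ c₁ c₂ c₃ =
    coeff-single ((c₀ ↑ 2) X^ 0 ∷ (c₁ ↑ 2) X^ 2 ∷ (c₂ ↑ 2) X^ 4 ∷ (c₃ ↑ 2) X^ 6 ∷ (c₀ ↑ 1) X^ 0 ∷ (c₁ ↑ 1) X^ 1 ∷ (c₂ ↑ 1) X^ 2 ∷ [])
                 (c₃ ↑ 1) {3} [] ((λ ()) ∷ (λ ()) ∷ (λ ()) ∷ (λ ()) ∷ (λ ()) ∷ (λ ()) ∷ (λ ()) ∷ []) []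

module Fq² (m : ℕ) (F : FiniteField ((2 ^ (2 ℕ.+ m)) ^ 2)) where
  open FiniteField F
  open FieldProperties F
  open Polynomials F
  open CharacteristicTwo F (characteristic-two ((2 ℕ.+ m) ℕ.* 2) (ℕ.^-*-assoc 2 (2 ℕ.+ m) 2))

  n q Q : ℕ
  n = 2 ℕ.+ m
  q = 2 ^ n
  Q = 2 ^ suc m

  h : Carrier → Carrier
  h = hsum n

  norm : Carrier → Carrier
  norm x = x ↑ (q ℕ.+ 1)

  ↑q↑q : ∀ x → (x ↑ q) ↑ q ≡ x
  ↑q↑q x = trans (↑-assocʳ x q q) (trans (cong (x ↑_) (cong (q ℕ.*_) (sym (ℕ.*-identityʳ q)))) (↑-card x))

  norm-fixed : ∀ x → norm x ↑ q ≡ norm x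
  norm-fixed x = begin
    (x ↑ (q ℕ.+ 1)) ↑ q         ≡⟨ cong (_↑ q) (↑-homo-* x q 1) ⟩
    (x ↑ q * x ↑ 1) ↑ q         ≡⟨ ↑-distrib-* (x ↑ q) (x ↑ 1) q ⟩
    (x ↑ q) ↑ q * (x ↑ 1) ↑ q   ≡⟨ cong₂ _*_ (↑q↑q x) (cong (_↑ q) (x↑1≡x x)) ⟩
    x * x ↑ q                   ≡⟨ *-comm x (x ↑ q) ⟩
    x ↑ q * x                   ≡⟨ cong (x ↑ q *_) (x↑1≡x x) ⟨
    x ↑ q * x ↑ 1               ≡⟨ ↑-homo-* x q 1 ⟨
    x ↑ (q ℕ.+ 1)               ∎

  norm-0 : norm 0# ≡ 0#
  norm-0 = 0↑k≡0 (ℕ.m≤n+m 1 q)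

  ↑q+1 : ∀ x → x ↑ (q ℕ.+ 1) ≡ x ↑ q * x
  ↑q+1 x = trans (↑-homo-* x q 1) (cong (x ↑ q *_) (x↑1≡x x))

  q≥4 : 4 ≤ q
  q≥4 = ℕ.^-monoʳ-≤ 2 {2} {n} (s≤s (s≤s z≤n))

  q<2q : q ℕ.< 2 ℕ.* q
  q<2q = ℕ.m<m+n q (ℕ.<-≤-trans (s≤s z≤n) (ℕ.≤-trans q≥4 (ℕ.m≤m+n q 0)))

  K I : List Carrier
  K = kernel h
  I = image h

  X : Polynomial
  X = 1# X^ 1 ∷ []

  ⟦cX⟧ : ∀ c y → ⟦ c X^ 1 ∷ [] ⟧ y ≡ c * y
  ⟦cX⟧ c y = trans (+-identityʳ _) (cong (c *_) (x↑1≡x y))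

  ⟦hsumᵖ-X⟧ : ∀ k y → ⟦ hsumᵖ k X ⟧ y ≡ hsum k y
  ⟦hsumᵖ-X⟧ k y = trans (⟦hsumᵖ⟧ k X y) (cong (hsum k) (trans (⟦cX⟧ 1# y) (*-identityˡ y)))

  kernel-bound : length K ≤ Q
  kernel-bound = subst (length K ≤_) (ℕ.*-identityˡ Q)
    (roots-bound (hsumᵖ n X) K (kernel-unique h) roots (hsumᵖ-degree (suc m) X (ℕ.≤-refl ∷ [])) leading≢0)
    where
    roots : All (λ k → ⟦ hsumᵖ n X ⟧ k ≡ 0#) K
    roots = All.tabulate λ {k} k∈K → trans (⟦hsumᵖ-X⟧ n k) (∈-kernel⁻ h k∈K)
    leading≢0 : coeff (hsumᵖ n X) Q ≢ 0#
    leading≢0 = subst (_≢ 0#) (sym (trans (coeff-hsumᵖ-monomial 1# {n} {suc m} ℕ.≤-refl) (1↑k≡1 Q))) 1≢0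

  -- (w² + w)^q + (w² + w), expanded by Frobenius
  annihilator : Polynomial
  annihilator = 1# X^ (2 ℕ.* q) ∷ 1# X^ q ∷ 1# X^ 2 ∷ 1# X^ 1 ∷ []

  annihilator-lower : All ((ℕ._< 2 ℕ.* q) ∘ exponent) (List.drop 1 annihilator)
  annihilator-lower = q<2q ∷ 2<2q ∷ ℕ.<-trans (s≤s (s≤s z≤n)) 2<2q ∷ []
    where
    2<2q : 2 ℕ.< 2 ℕ.* q
    2<2q = ℕ.<-≤-trans (s≤s (s≤s (s≤s z≤n))) (ℕ.≤-trans q≥4 (ℕ.<⇒≤ q<2q))

  annihilator-degree : All ((_≤ 2 ℕ.* q) ∘ exponent) annihilator
  annihilator-degree = ℕ.≤-refl ∷ All.map ℕ.<⇒≤ annihilator-lower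

  annihilator-leading≢0 : coeff annihilator (2 ℕ.* q) ≢ 0#
  annihilator-leading≢0 = subst (_≢ 0#) (sym (coeff-single [] 1# (List.drop 1 annihilator) [] (All.map ℕ.<⇒≢ annihilator-lower))) 1≢0

  annihilator-root : ∀ w → (w ↑ 2 + w) ↑ q ≡ w ↑ 2 + w → ⟦ annihilator ⟧ w ≡ 0#
  annihilator-root w fixed = begin
    1# * w ↑ (2 ℕ.* q) + (1# * w ↑ q + (1# * w ↑ 2 + (1# * w ↑ 1 + 0#)))
      ≡⟨ cong₂ _+_ (*-identityˡ _) (cong₂ _+_ (*-identityˡ _) (cong₂ _+_ (*-identityˡ _)
           (trans (+-identityʳ _) (trans (*-identityˡ _) (x↑1≡x w))))) ⟩
    w ↑ (2 ℕ.* q) + (w ↑ q + u)           ≡⟨ cong (_+ (w ↑ q + u)) (↑-assocʳ w 2 q) ⟨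
    (w ↑ 2) ↑ q + (w ↑ q + u)             ≡⟨ +-assoc _ _ _ ⟨
    ((w ↑ 2) ↑ q + w ↑ q) + u             ≡⟨ cong (_+ u) (frobenius n (w ↑ 2) w) ⟨
    u ↑ q + u                             ≡⟨ cong (_+ u) fixed ⟩
    u + u                                 ≡⟨ x+x≡0 u ⟩
    0#                                    ∎
    where
    u = w ↑ 2 + w

  image-root : ∀ y → ⟦ annihilator ⟧ (h y) ≡ 0#
  image-root y = annihilator-root (h y) (begin
    (h y ↑ 2 + h y) ↑ q    ≡⟨ cong (_↑ q) (hsum-square n y) ⟩
    (y ↑ q + y) ↑ q        ≡⟨ frobenius n (y ↑ q) y ⟩
    (y ↑ q) ↑ q + y ↑ q    ≡⟨ cong (_+ y ↑ q) (↑q↑q y) ⟩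
    y + y ↑ q              ≡⟨ +-comm y (y ↑ q) ⟩
    y ↑ q + y              ≡⟨ hsum-square n y ⟨
    h y ↑ 2 + h y          ∎)

  norm-root : ∀ x → ⟦ annihilator ⟧ (norm x) ≡ 0#
  norm-root x = annihilator-root w (begin
    (w ↑ 2 + w) ↑ q        ≡⟨ frobenius n (w ↑ 2) w ⟩
    (w ↑ 2) ↑ q + w ↑ q    ≡⟨ cong (_+ w ↑ q) (trans (↑-assocʳ w 2 q) (trans (cong (w ↑_) (ℕ.*-comm 2 q)) (sym (↑-assocʳ w q 2)))) ⟩
    (w ↑ q) ↑ 2 + w ↑ q    ≡⟨ cong (λ t → t ↑ 2 + t) (norm-fixed x) ⟩
    w ↑ 2 + w              ∎)
    where
    w = norm x

  image-roots : All (λ w → ⟦ annihilator ⟧ w ≡ 0#) I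
  image-roots = All.tabulate λ w∈I → let y , hy≡w = ∈-image⁻ h w∈I in subst (λ w → ⟦ annihilator ⟧ w ≡ 0#) hy≡w (image-root y)

  image-bound : length I ≤ 2 ℕ.* q
  image-bound = roots-bound annihilator I (image-unique h) image-roots annihilator-degree annihilator-leading≢0

  card≡2q*Q : (2 ℕ.* q) ℕ.* Q ≡ q ^ 2
  card≡2q*Q = lemma Q
    where
    lemma : ∀ x → (2 ℕ.* (2 ℕ.* x)) ℕ.* x ≡ (2 ℕ.* x) ℕ.* ((2 ℕ.* x) ℕ.* 1)
    lemma = solve-∀

  image-size×kernel-size : 2 ℕ.* q ≤ length I × Q ≤ length K
  image-size×kernel-size = ≤-*-tight (ℕ.m^n>0 2 (suc n)) (ℕ.m^n>0 2 (suc m))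
    (subst (_≤ length I ℕ.* length K) (sym card≡2q*Q) (card≤image*kernel h (hsum-homo-+ n)))
    image-bound kernel-bound

  fiber : ∀ x → ∃ λ y → h y ≡ norm x
  fiber x with Any.any? (norm x ≟_) I
  ... | yes w∈I = ∈-image⁻ h w∈I
  ... | no  w∉I = contradiction
    (roots-bound annihilator (norm x ∷ I) (All.¬Any⇒All¬ I w∉I ∷ image-unique h) (norm-root x ∷ image-roots)
                 annihilator-degree annihilator-leading≢0)
    (ℕ.<⇒≱ (s≤s (proj₁ image-size×kernel-size)))

  nonzero-kernel-element : ∃ λ k → h k ≡ 0# × k ≢ 0#
  nonzero-kernel-element =
    map₂ (map₁ (∈-kernel⁻ h)) (∃-∈-≢ _≟_ 0# (kernel-unique h) (ℕ.≤-trans 2≤Q (proj₂ image-size×kernel-size)))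
    where
    2≤Q : 2 ≤ Q
    2≤Q = ℕ.^-monoʳ-≤ 2 {1} {suc m} (s≤s z≤n)

  top-term : ∀ {y} → h y ≡ 0# → y ↑ Q ≡ hsum (suc m) y
  top-term = x+y≡0⇒x≡y

  kernel-scalar : ∀ c → c ≢ 0# → (∀ k → h k ≡ 0# → h (c * k) ≡ 0#) → c ≡ 1#
  kernel-scalar c c≢0 invariant = *-cancelˡ-nonZero c c 1# c≢0 (begin
    c * c       ≡⟨ x↑2≡x*x c ⟨
    c ↑ 2       ≡⟨ c↑2≡c↑Q ⟩
    c ↑ Q       ≡⟨ coeff-2^ 0 (s≤s z≤n) ⟨
    c ↑ 1       ≡⟨ x↑1≡x c ⟩
    c           ≡⟨ *-identityʳ c ⟨
    c * 1#      ∎)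
    where
    degree : ∀ {a} → All ((ℕ._< length K) ∘ exponent) (hsumᵖ (suc m) (a X^ 1 ∷ []))
    degree = All.map (λ e≤2^m → ℕ.<-≤-trans (ℕ.≤-<-trans e≤2^m 2^m<Q) (proj₂ image-size×kernel-size))
                     (hsumᵖ-degree m _ (ℕ.≤-refl ∷ []))
      where
      2^m<Q : 1 ℕ.* 2 ^ m ℕ.< Q
      2^m<Q = subst (ℕ._< Q) (sym (ℕ.*-identityˡ _)) (ℕ.^-monoʳ-< 2 ℕ.≤-refl (ℕ.n<1+n m))
    agree : All (λ k → ⟦ hsumᵖ (suc m) (c X^ 1 ∷ []) ⟧ k ≡ ⟦ scale (c ↑ Q) (hsumᵖ (suc m) X) ⟧ k) K
    agree = All.tabulate λ {k} k∈K → begin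
      ⟦ hsumᵖ (suc m) (c X^ 1 ∷ []) ⟧ k          ≡⟨ trans (⟦hsumᵖ⟧ (suc m) (c X^ 1 ∷ []) k) (cong (hsum (suc m)) (⟦cX⟧ c k)) ⟩
      hsum (suc m) (c * k)                       ≡⟨ top-term (invariant k (∈-kernel⁻ h k∈K)) ⟨
      (c * k) ↑ Q                                ≡⟨ ↑-distrib-* c k Q ⟩
      c ↑ Q * k ↑ Q                              ≡⟨ cong (c ↑ Q *_) (trans (top-term (∈-kernel⁻ h k∈K)) (sym (⟦hsumᵖ-X⟧ (suc m) k))) ⟩
      c ↑ Q * ⟦ hsumᵖ (suc m) X ⟧ k              ≡⟨ ⟦scale⟧ (c ↑ Q) (hsumᵖ (suc m) X) k ⟨
      ⟦ scale (c ↑ Q) (hsumᵖ (suc m) X) ⟧ k      ∎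
    coeff-2^ : ∀ i → i ℕ.< suc m → c ↑ 2 ^ i ≡ c ↑ Q
    coeff-2^ i i<1+m = begin
      c ↑ 2 ^ i                                         ≡⟨ coeff-hsumᵖ-monomial c {suc m} i<1+m ⟨
      coeff (hsumᵖ (suc m) (c X^ 1 ∷ [])) (2 ^ i)       ≡⟨ coeff-agree (hsumᵖ (suc m) (c X^ 1 ∷ [])) (scale (c ↑ Q) (hsumᵖ (suc m) X)) K (kernel-unique h) agree degree (All.map⁺ degree) (2 ^ i) ⟩
      coeff (scale (c ↑ Q) (hsumᵖ (suc m) X)) (2 ^ i)   ≡⟨ coeff-scale (c ↑ Q) (hsumᵖ (suc m) X) (2 ^ i) ⟩
      c ↑ Q * coeff (hsumᵖ (suc m) X) (2 ^ i)           ≡⟨ cong (c ↑ Q *_) (trans (coeff-hsumᵖ-monomial 1# {suc m} i<1+m) (1↑k≡1 (2 ^ i))) ⟩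
      c ↑ Q * 1#                                        ≡⟨ *-identityʳ _ ⟩
      c ↑ Q                                             ∎
    c↑2≡c↑Q : c ↑ 2 ≡ c ↑ Q
    c↑2≡c↑Q with m ℕ.≟ 0
    ... | yes m≡0 = cong (λ k → c ↑ 2 ^ suc k) (sym m≡0)
    ... | no  m≢0 = coeff-2^ 1 (s≤s (ℕ.n≢0⇒n>0 m≢0))

  normᵖ : Polynomial
  normᵖ = 1# X^ (q ℕ.+ 1) ∷ []

  ⟦normᵖ⟧ : ∀ z → ⟦ normᵖ ⟧ z ≡ norm z
  ⟦normᵖ⟧ z = trans (+-identityʳ _) (*-identityˡ _)

  norm-affineᵖ : Carrier → Carrier → Polynomial
  norm-affineᵖ a b = (a ↑ (q ℕ.+ 1)) X^ (q ℕ.+ 1) ∷ (a ↑ q * b) X^ q ∷ (a * b ↑ q) X^ 1 ∷ (b ↑ (q ℕ.+ 1)) X^ 0 ∷ []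

  ⟦norm-affineᵖ⟧ : ∀ a b z → ⟦ norm-affineᵖ a b ⟧ z ≡ norm (a * z + b)
  ⟦norm-affineᵖ⟧ a b z = begin
    a ↑ (q ℕ.+ 1) * z ↑ (q ℕ.+ 1) + (A * b * Z + (a * B * z ↑ 1 + (b ↑ (q ℕ.+ 1) * 1# + 0#)))
      ≡⟨ cong₂ (λ u v → u + (A * b * Z + v)) (cong₂ _*_ (↑q+1 a) (↑q+1 z))
               (cong₂ _+_ (cong (a * B *_) (x↑1≡x z)) (trans (+-identityʳ _) (trans (*-identityʳ _) (↑q+1 b)))) ⟩
    (A * a) * (Z * z) + (A * b * Z + (a * B * z + B * b))
      ≡⟨ solve 6 (λ a b z A B Z → ((A :* a) :* (Z :* z) :+ (A :* b :* Z :+ (a :* B :* z :+ B :* b))) := ((A :* Z :+ B) :* (a :* z :+ b))) refl a b z A B Z ⟩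
    (A * Z + B) * (a * z + b)              ≡⟨ cong (λ t → (t + B) * (a * z + b)) (↑-distrib-* a z q) ⟨
    ((a * z) ↑ q + B) * (a * z + b)        ≡⟨ cong (_* (a * z + b)) (frobenius n (a * z) b) ⟨
    (a * z + b) ↑ q * (a * z + b)          ≡⟨ ↑q+1 (a * z + b) ⟨
    norm (a * z + b)                       ∎
    where
    A = a ↑ q
    B = b ↑ q
    Z = z ↑ q

  norms-lowᵖ : Carrier → Carrier → Polynomial
  norms-lowᵖ a b = (a * b ↑ q) X^ 1 ∷ (b ↑ (q ℕ.+ 1)) X^ 0 ∷ []

  coeff-norms-low : ∀ a b {d} → d ℕ.< 4 → coeff (normᵖ ++ norm-affineᵖ a b) d ≡ coeff (norms-lowᵖ a b) d
  coeff-norms-low a b {d} d<4 = begin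
    coeff (high ++ norms-lowᵖ a b) d               ≡⟨ coeff-++ high (norms-lowᵖ a b) d ⟩
    coeff high d + coeff (norms-lowᵖ a b) d        ≡⟨ cong (_+ coeff (norms-lowᵖ a b) d) (coeff-absent high (q+1≢d ∷ q+1≢d ∷ q≢d ∷ [])) ⟩
    0# + coeff (norms-lowᵖ a b) d                  ≡⟨ +-identityˡ _ ⟩
    coeff (norms-lowᵖ a b) d                       ∎
    where
    high : Polynomial
    high = 1# X^ (q ℕ.+ 1) ∷ (a ↑ (q ℕ.+ 1)) X^ (q ℕ.+ 1) ∷ (a ↑ q * b) X^ q ∷ []
    q≢d : q ≢ d
    q≢d = ℕ.>⇒≢ (ℕ.<-≤-trans d<4 q≥4)
    q+1≢d : q ℕ.+ 1 ≢ d
    q+1≢d = ℕ.>⇒≢ (ℕ.<-≤-trans d<4 (ℕ.≤-trans q≥4 (ℕ.m≤m+n q 1)))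

  below-card : ∀ {e} → e ≤ 2 ℕ.* q → e ℕ.< length elements
  below-card e≤2q = ℕ.≤-<-trans e≤2q (subst (2 ℕ.* q ℕ.<_) (trans (cong (q ℕ.*_) (sym (ℕ.*-identityʳ q))) (sym length-elements))
                                             (ℕ.*-monoˡ-< q {{ℕ.>-nonZero (ℕ.m^n>0 2 n)}} (ℕ.<-≤-trans (s≤s (s≤s (s≤s z≤n))) q≥4)))

  affine-on-fiber : ∀ {a₁ a₂ u₁ u₂} x → (∀ y → h y ≡ norm x → a₁ * y + u₁ ≡ a₂ * y + u₂) → a₁ ≡ a₂ × u₁ ≡ u₂
  affine-on-fiber {a₁} {a₂} {u₁} {u₂} x on-fiber = a₁≡a₂ , ∙-cancelˡ (a₂ * y) u₁ u₂ (subst (λ a → a * y + u₁ ≡ a₂ * y + u₂) a₁≡a₂ (on-fiber y hy))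
    where
    y = proj₁ (fiber x)
    hy : h y ≡ norm x
    hy = proj₂ (fiber x)
    k = proj₁ nonzero-kernel-element
    hy+k : h (y + k) ≡ norm x
    hy+k = trans (hsum-homo-+ n y k) (trans (cong₂ _+_ hy (proj₁ (proj₂ nonzero-kernel-element))) (+-identityʳ _))
    a₁≡a₂ : a₁ ≡ a₂
    a₁≡a₂ = slopes-agree (proj₂ (proj₂ nonzero-kernel-element)) (on-fiber y hy) (on-fiber (y + k) hy+k)

  restriction-injective : (a₁ a₂ : Carrier) (p₁ p₂ : Poly≤3) (J : Subset (q ^ 2)) → 4 ≤ ∣ J ∣ →
    (∀ j → j ∈ J → ∀ y → h y ≡ norm (element j) → a₁ * y + eval p₁ (element j) ≡ a₂ * y + eval p₂ (element j)) →
    (a₁ ≡ a₂) × (p₁ ≡ p₂)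
  restriction-injective a₁ a₂ p₁ p₂ J 4≤∣J∣ on-curve =
    proj₁ (on-fiber j₀∈J) ,
    cubic-determined p₁ p₂ (List.map element (members J))
      (Unique.map⁺ (Injection.injective (↔⇒↣ enum)) (members-unique J))
      (subst (4 ≤_) (sym (List.length-map element (members J))) 4≤∣members∣)
      (All.map⁺ (All.tabulate (proj₂ ∘ on-fiber ∘ ∈-members⁻ J)))
    where
    on-fiber : ∀ {j} → j ∈ J → a₁ ≡ a₂ × eval p₁ (element j) ≡ eval p₂ (element j)
    on-fiber {j} j∈J = affine-on-fiber (element j) (on-curve j j∈J)
    4≤∣members∣ : 4 ≤ length (members J)
    4≤∣members∣ = subst (4 ≤_) (sym (length-members J)) 4≤∣J∣
    some-member : ∃ (_∈ₗ members J)
    some-member = ∃-∈ (ℕ.<-≤-trans (s≤s z≤n) 4≤∣members∣)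
    j₀∈J : proj₁ some-member ∈ J
    j₀∈J = ∈-members⁻ J (proj₂ some-member)

  PreservesCurve : Carrier → Carrier → Carrier → Poly≤3 → Set
  PreservesCurve a b c s = ∀ x y → h y ≡ norm x → h (c * y + eval s x) ≡ norm (a * x + b)

  preserves-kernel : ∀ {a b c s} → PreservesCurve a b c s → ∀ k → h k ≡ 0# → h (c * k) ≡ 0#
  preserves-kernel {a} {b} {c} {s} preserves k hk≡0 = ∙-cancelʳ (h u) _ _ (begin
    h (c * k) + h u      ≡⟨ hsum-homo-+ n (c * k) u ⟨
    h (c * k + u)        ≡⟨ preserves 0# k (trans hk≡0 (sym norm-0)) ⟩
    norm (a * 0# + b)    ≡⟨ preserves 0# 0# (trans (hsum-0 n) (sym norm-0)) ⟨
    h (c * 0# + u)       ≡⟨ cong (λ t → h (t + u)) (zeroʳ c) ⟩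
    h (0# + u)           ≡⟨ cong h (+-identityˡ u) ⟩
    h u                  ≡⟨ +-identityˡ (h u) ⟨
    0# + h u             ∎)
    where
    u = eval s 0#

  h∘s≡norms : ∀ {a b s} → PreservesCurve a b 1# s → ∀ x → h (eval s x) ≡ norm x + norm (a * x + b)
  h∘s≡norms {a} {b} {s} preserves x = x+y≡z⇒y≡x+z (begin
    norm x + h (eval s x)   ≡⟨ cong (_+ h (eval s x)) hy ⟨
    h y + h (eval s x)      ≡⟨ hsum-homo-+ n y (eval s x) ⟨
    h (y + eval s x)        ≡⟨ cong (λ t → h (t + eval s x)) (*-identityˡ y) ⟨
    h (1# * y + eval s x)   ≡⟨ preserves x y hy ⟩
    norm (a * x + b)        ∎)
    where
    y = proj₁ (fiber x)
    hy : h y ≡ norm x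
    hy = proj₂ (fiber x)

  low-coeffs : ∀ a b s → (∀ x → h (eval s x) ≡ norm x + norm (a * x + b)) →
               ∀ {d} → 0 ℕ.< d → d ℕ.< 4 → coeff (hsumᵖ 2 (toPolynomial s)) d ≡ coeff (norms-lowᵖ a b) d
  low-coeffs a b s h∘s {d} 0<d d<4 = begin
    coeff (hsumᵖ 2 (toPolynomial s)) d  ≡⟨ coeff-hsumᵖ-low m (toPolynomial s) 0<d d<4 ⟨
    coeff lhsᵖ d                        ≡⟨ coeff-agree lhsᵖ rhsᵖ elements elements-unique agree
                                             (All.map below-card lhs-degree) (All.map below-card rhs-degree) d ⟩
    coeff rhsᵖ d                        ≡⟨ coeff-norms-low a b d<4 ⟩
    coeff (norms-lowᵖ a b) d            ∎
    where
    lhsᵖ rhsᵖ : Polynomial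
    lhsᵖ = hsumᵖ n (toPolynomial s)
    rhsᵖ = normᵖ ++ norm-affineᵖ a b
    agree : All (λ x → ⟦ lhsᵖ ⟧ x ≡ ⟦ rhsᵖ ⟧ x) elements
    agree = All.tabulate λ {x} _ → begin
      ⟦ lhsᵖ ⟧ x                             ≡⟨ ⟦hsumᵖ⟧ n (toPolynomial s) x ⟩
      h (⟦ toPolynomial s ⟧ x)               ≡⟨ cong h (eval≡⟦toPolynomial⟧ s x) ⟨
      h (eval s x)                           ≡⟨ h∘s x ⟩
      norm x + norm (a * x + b)              ≡⟨ cong₂ _+_ (⟦normᵖ⟧ x) (⟦norm-affineᵖ⟧ a b x) ⟨
      ⟦ normᵖ ⟧ x + ⟦ norm-affineᵖ a b ⟧ x   ≡⟨ ⟦++⟧ normᵖ (norm-affineᵖ a b) x ⟨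
      ⟦ rhsᵖ ⟧ x                             ∎
    lhs-degree : All ((_≤ 2 ℕ.* q) ∘ exponent) lhsᵖ
    lhs-degree = All.map (λ e≤3Q → ℕ.≤-trans e≤3Q 3Q≤2q)
                         (hsumᵖ-degree (suc m) (toPolynomial s) (All.map ℕ.s≤s⁻¹ (toPolynomial-degree s)))
      where
      3Q≤2q : 3 ℕ.* Q ≤ 2 ℕ.* q
      3Q≤2q = ℕ.≤-trans (ℕ.*-monoˡ-≤ Q {3} {4} (ℕ.n≤1+n 3)) (ℕ.≤-reflexive (ℕ.*-assoc 2 2 Q))
    rhs-degree : All ((_≤ 2 ℕ.* q) ∘ exponent) rhsᵖ
    rhs-degree = q+1≤2q ∷ q+1≤2q ∷ q≤2q ∷ ℕ.≤-trans (ℕ.<⇒≤ (ℕ.<-≤-trans (s≤s (s≤s z≤n)) q≥4)) q≤2q ∷ z≤n ∷ []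
      where
      q≤2q : q ≤ 2 ℕ.* q
      q≤2q = ℕ.<⇒≤ q<2q
      q+1≤2q : q ℕ.+ 1 ≤ 2 ℕ.* q
      q+1≤2q = ℕ.+-monoʳ-≤ q (ℕ.≤-trans (ℕ.<-≤-trans (s≤s z≤n) q≥4) (ℕ.m≤m+n q 0))

  shape-of-s : ∀ a b s → (∀ x → h (eval s x) ≡ norm x + norm (a * x + b)) →
               ∃ λ e → (s ≡ e ∷ a * (b ↑ q) ∷ (a ↑ 2) * (b ↑ (2 ℕ.* q)) ∷ 0# ∷ []) × ((b ↑ (q ℕ.+ 1)) ≡ h e)
  shape-of-s a b s@(s₀ ∷ s₁ ∷ s₂ ∷ s₃ ∷ []) h∘s = s₀ , s≡ , norm-b≡hs₀
    where
    s₁≡ : s₁ ≡ a * b ↑ q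
    s₁≡ = trans (sym (x↑1≡x s₁)) (trans (sym (coeff-hsum₂-x s₀ s₁ s₂ s₃)) (trans (low-coeffs a b s h∘s (s≤s z≤n) (s≤s (s≤s z≤n)))
                (coeff-single [] (a * b ↑ q) {1} ((b ↑ (q ℕ.+ 1)) X^ 0 ∷ []) [] ((λ ()) ∷ []))))
    s₁²≡s₂ : s₁ ↑ 2 ≡ s₂ ↑ 1
    s₁²≡s₂ = x+y≡0⇒x≡y (trans (sym (coeff-hsum₂-x² s₀ s₁ s₂ s₃)) (trans (low-coeffs a b s h∘s (s≤s z≤n) (s≤s (s≤s (s≤s z≤n))))
                (coeff-absent (norms-lowᵖ a b) {2} ((λ ()) ∷ (λ ()) ∷ []))))
    s₃≡0 : s₃ ≡ 0#
    s₃≡0 = trans (sym (x↑1≡x s₃)) (trans (sym (coeff-hsum₂-x³ s₀ s₁ s₂ s₃)) (trans (low-coeffs a b s h∘s (s≤s z≤n) ℕ.≤-refl)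
                (coeff-absent (norms-lowᵖ a b) {3} ((λ ()) ∷ (λ ()) ∷ []))))
    s₂≡ : s₂ ≡ a ↑ 2 * b ↑ (2 ℕ.* q)
    s₂≡ = begin
      s₂                          ≡⟨ x↑1≡x s₂ ⟨
      s₂ ↑ 1                      ≡⟨ s₁²≡s₂ ⟨
      s₁ ↑ 2                      ≡⟨ cong (_↑ 2) s₁≡ ⟩
      (a * b ↑ q) ↑ 2             ≡⟨ ↑-distrib-* a (b ↑ q) 2 ⟩
      a ↑ 2 * (b ↑ q) ↑ 2         ≡⟨ cong (a ↑ 2 *_) (↑-assocʳ b q 2) ⟩
      a ↑ 2 * b ↑ (q ℕ.* 2)       ≡⟨ cong (λ t → a ↑ 2 * b ↑ t) (ℕ.*-comm q 2) ⟩
      a ↑ 2 * b ↑ (2 ℕ.* q)       ∎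
    s≡ : s ≡ s₀ ∷ a * (b ↑ q) ∷ (a ↑ 2) * (b ↑ (2 ℕ.* q)) ∷ 0# ∷ []
    s≡ = cong₂ _∷_ refl (cong₂ _∷_ s₁≡ (cong₂ _∷_ s₂≡ (cong₂ _∷_ s₃≡0 refl)))
    norm-b≡hs₀ : b ↑ (q ℕ.+ 1) ≡ h s₀
    norm-b≡hs₀ = begin
      norm b                        ≡⟨ cong norm (trans (cong (_+ b) (zeroʳ a)) (+-identityˡ b)) ⟨
      norm (a * 0# + b)             ≡⟨ +-identityˡ _ ⟨
      0# + norm (a * 0# + b)        ≡⟨ cong (_+ norm (a * 0# + b)) norm-0 ⟨
      norm 0# + norm (a * 0# + b)   ≡⟨ h∘s 0# ⟨
      h (eval s 0#)                 ≡⟨ cong h (eval-0 s) ⟩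
      h s₀                          ∎

  curve-map-shape : ∀ a b c s → c ≢ 0# → PreservesCurve a b c s →
    (c ≡ 1#) × ∃ λ e → (s ≡ e ∷ a * (b ↑ q) ∷ (a ↑ 2) * (b ↑ (2 ℕ.* q)) ∷ 0# ∷ []) × ((b ↑ (q ℕ.+ 1)) ≡ h e)
  curve-map-shape a b c s c≢0 preserves =
    c≡1 , shape-of-s a b s (h∘s≡norms {a} {b} {s} (subst (λ c → PreservesCurve a b c s) c≡1 preserves))
    where
    c≡1 : c ≡ 1#
    c≡1 = kernel-scalar c c≢0 (preserves-kernel {a} {b} {c} {s} preserves)

lemma5p7 : (n : ℕ) → 2 ≤ n → (F : FiniteField ((2 ^ n) ^ 2)) →
    let open FiniteField F
        q = 2 ^ n
        h = hsum n
        x : Fin (q ^ 2) → Carrier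
        x = Inverse.to enum
    in ((a₁ a₂ : Carrier) (p₁ p₂ : Poly≤3) (J : Subset (q ^ 2)) →
         4 ≤ ∣ J ∣ →
         (∀ j → j ∈ J → ∀ y → h y ≡ (x j) ↑ (q ℕ.+ 1) →
            a₁ * y + eval p₁ (x j) ≡ a₂ * y + eval p₂ (x j)) →
         (a₁ ≡ a₂) × (p₁ ≡ p₂))
     × ((a b c : Carrier) (s : Poly≤3) → a ≢ 0# → c ≢ 0# →
         (∀ j → ∀ y → h y ≡ (x j) ↑ (q ℕ.+ 1) →
            h (c * y + eval s (x j)) ≡ (a * x j + b) ↑ (q ℕ.+ 1)) →
         (c ≡ 1#) ×
         ∃ λ e → (s ≡ e ∷ a * (b ↑ q) ∷ (a ↑ 2) * (b ↑ (2 ℕ.* q)) ∷ 0# ∷ [])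
               × ((b ↑ (q ℕ.+ 1)) ≡ h e))
lemma5p7 (suc (suc m)) (s≤s (s≤s z≤n)) F =
  restriction-injective , λ a b c s _ c≢0 on-curve → curve-map-shape a b c s c≢0 (∀-elements on-curve)
  where
  open Fq² m F
  open FieldProperties F using (∀-elements)
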